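{- Let $D$ be the derivation on polynomials in $a,x,y$ with $D(a)=ax$, $D(x)=xy$, $D(y)=x^2$, and $\mathrm{Gen}(a,t)=\sum_{n\ge0}D^n(a)\frac{t^n}{n!}$. Writing $s=\sqrt{y^2-x^2}$, $$\mathrm{Gen}(a,t)=a(y-x)\,\frac{y+s+2x e^{st}+(y-s)e^{2st}}{y^2-x^2+ys+(y^2-x^2-ys)e^{2st}}.$$
   Context: The identity is of formal power series in $t$ whose coefficients lie in the field obtained from $\mathbb{Q}(a,x,y)$ by adjoining a square root $s$ of $y^2-x^2$. -}

module Defs where

open import Data.Nat as ℕ using (ℕ; zero; suc; _∸_; _!)
open import Data.Nat.Properties using (_!≢0)
open import Data.Integer as ℤ using (+_)
open import Data.Rational as ℚ using (ℚ; 0ℚ; 1ℚ; _/_) renaming (_+_ to _+ℚ_; _*_ to _*ℚ_; -_ to -ℚ_)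
open import Data.Product using (_×_; _,_; proj₁; proj₂)
open import Relation.Binary.PropositionalEquality using (_≡_)

sumUpTo : {A : Set} → A → (A → A → A) → ℕ → (ℕ → A) → A
sumUpTo z _⊕_ zero    f = z ⊕ f zero
sumUpTo z _⊕_ (suc n) f = sumUpTo z _⊕_ n f ⊕ f (suc n)

-- ℚ[a,x,y] : a polynomial is given by its coefficient function
--   (i , j , k) ↦ coefficient of a^i x^j y^k.
-- Equality is coefficientwise.

Poly : Set
Poly = ℕ → ℕ → ℕ → ℚ

infix 4 _≈P_
_≈P_ : Poly → Poly → Set
p ≈P q = ∀ i j k → p i j k ≡ q i j k

infixl 6 _+P_ _-P_
infixl 7 _*P_

0P : Poly
0P _ _ _ = 0ℚ

constP : ℚ → Poly
constP c zero zero zero = c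
constP c _    _    _    = 0ℚ

1P : Poly
1P = constP 1ℚ

_+P_ : Poly → Poly → Poly
(p +P q) i j k = p i j k +ℚ q i j k

-P_ : Poly → Poly
(-P p) i j k = -ℚ p i j k

_-P_ : Poly → Poly → Poly
p -P q = p +P (-P q)

_*P_ : Poly → Poly → Poly
(p *P q) i j k =
  sumUpTo 0ℚ _+ℚ_ i λ i₁ → sumUpTo 0ℚ _+ℚ_ j λ j₁ → sumUpTo 0ℚ _+ℚ_ k λ k₁ →
    p i₁ j₁ k₁ *ℚ q (i ∸ i₁) (j ∸ j₁) (k ∸ k₁)

varA varX varY : Poly
varA (suc zero) zero zero = 1ℚ
varA _ _ _ = 0ℚ
varX zero (suc zero) zero = 1ℚ
varX _ _ _ = 0ℚ
varY zero zero (suc zero) = 1ℚ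
varY _ _ _ = 0ℚ

natℚ : ℕ → ℚ
natℚ n = + n / 1

∂a ∂x ∂y : Poly → Poly
∂a p i j k = natℚ (suc i) *ℚ p (suc i) j k
∂x p i j k = natℚ (suc j) *ℚ p i (suc j) k
∂y p i j k = natℚ (suc k) *ℚ p i j (suc k)

D : Poly → Poly
D f = (varA *P varX) *P ∂a f +P (varX *P varY) *P ∂x f +P (varX *P varX) *P ∂y f

iterate : ℕ → (Poly → Poly) → Poly → Poly
iterate zero    g p = p
iterate (suc n) g p = g (iterate n g p)

-- R = ℚ[a,x,y][s] with s² = y² - x², elements p + q·s stored as (p , q).
-- (y² - x² is not a square in ℚ(a,x,y), so R is a subring of the field
--  ℚ(a,x,y)(s) of the paper.)

R : Set
R = Poly × Poly

infix 4 _≈R_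
_≈R_ : R → R → Set
u ≈R v = (proj₁ u ≈P proj₁ v) × (proj₂ u ≈P proj₂ v)

Δ : Poly
Δ = varY *P varY -P varX *P varX

infixl 6 _+R_ _-R_
infixl 7 _*R_

_+R_ : R → R → R
(p , q) +R (p' , q') = (p +P p') , (q +P q')

_-R_ : R → R → R
(p , q) -R (p' , q') = (p -P p') , (q -P q')

_*R_ : R → R → R
(p , q) *R (p' , q') = (p *P p' +P (q *P q') *P Δ) , (p *P q' +P q *P p')

0R 1R : R
0R = 0P , 0P
1R = 1P , 0P

poly : Poly → R
poly p = p , 0P

ratR : ℚ → R
ratR c = poly (constP c)

aR xR yR sR : R
aR = poly varA
xR = poly varX
yR = poly varY
sR = 0P , 1P

powR : R → ℕ → R
powR u zero    = 1R
powR u (suc n) = powR u n *R u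

-- Formal power series in t over R: n ↦ coefficient of t^n.

PS : Set
PS = ℕ → R

infix 4 _≈PS_
_≈PS_ : PS → PS → Set
f ≈PS g = ∀ n → f n ≈R g n

infixl 6 _+PS_
infixl 7 _*PS_

_+PS_ : PS → PS → PS
(f +PS g) n = f n +R g n

_*PS_ : PS → PS → PS
(f *PS g) n = sumUpTo 0R _+R_ n λ k → f k *R g (n ∸ k)

constPS : R → PS
constPS u zero    = u
constPS u (suc _) = 0R

scalePS : R → PS → PS
scalePS u f n = u *R f n

1/! : ℕ → ℚ
1/! n = (+ 1 / (n !)) {{n !≢0}}

expPS : R → PS
expPS c n = ratR (1/! n) *R powR c n

Gen : PS
Gen n = ratR (1/! n) *R poly (iterate n D varA)

Num : PS
Num = constPS (yR +R sR)
      +PS scalePS (ratR (+ 2 / 1) *R xR) (expPS sR)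
      +PS scalePS (yR -R sR) (expPS (ratR (+ 2 / 1) *R sR))

Den : PS
Den = constPS (poly Δ +R yR *R sR)
      +PS scalePS (poly Δ -R yR *R sR) (expPS (ratR (+ 2 / 1) *R sR))

-- Put w = x + y and W = Σ Dⁿ(w) tⁿ/n!.  Since D a = a x and D w = x w, Gen · w = a · W.
-- Since 2 D w = w² − δ with δ = y² − x² = s² and D δ = 0, W satisfies the Riccati equation
-- 2 W′ = W² − δ.  With M = Den and N = δ · Num, the quotient N/M satisfies the same equation
-- (because (e^{st})′ = s e^{st} and s² = δ) and the same initial condition, so the linear
-- equation obeyed by W M − N forces W M = N.  Hence Gen · Den · w = a · N = a (y − x) · Num · w,
-- and w is a non-zero-divisor.
module Submission where

open import Level using (0ℓ)
open import Data.Nat as ℕ using (ℕ; zero; suc; pred; _∸_; _≤_; _<_; z≤n; s≤s; _!)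
import Data.Nat.Properties as ℕP
open import Data.Nat.Induction using (<-rec)
open import Data.Integer as ℤ using (+_)
import Data.Integer.Properties as ℤP
open import Data.Rational as ℚ using (ℚ; 0ℚ; 1ℚ; _/_; fromℚᵘ)
  renaming (_+_ to _+ℚ_; _*_ to _*ℚ_; -_ to -ℚ_)
import Data.Rational.Properties as ℚP
open import Data.Rational.Unnormalised as ℚᵘ using (ℚᵘ; mkℚᵘ; *≡*)
import Data.Rational.Unnormalised.Properties as ℚᵘP
open import Data.Product using (_,_; proj₁; proj₂)
open import Data.Maybe using (Maybe; just; nothing)
open import Relation.Nullary using (yes; no)
open import Relation.Binary.PropositionalEquality as ≡ using (_≡_)
open import Algebra.Bundles using (CommutativeRing)
open import Algebra.Structures using (IsCommutativeRing)
open import Algebra.Solver.Ring.AlmostCommutativeRing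
  using (AlmostCommutativeRing; fromCommutativeRing; _-Raw-AlmostCommutative⟶_)
import Algebra.Properties.Group
import Algebra.Properties.Ring
import Algebra.Solver.Ring
import Relation.Binary.Reasoning.Setoid

open import Defs hiding (Gen; Num; Den)

module Factorials where

  open ≡ using (refl; cong; cong₂; sym; trans)

  private
    fromℚᵘ-+ : ∀ p q → fromℚᵘ (p ℚᵘ.+ q) ≡ fromℚᵘ p +ℚ fromℚᵘ q
    fromℚᵘ-+ p q = ℚP.toℚᵘ-injective (ℚᵘP.≃-trans (ℚP.toℚᵘ-fromℚᵘ (p ℚᵘ.+ q))
      (ℚᵘP.≃-sym (ℚᵘP.≃-trans (ℚP.toℚᵘ-homo-+ (fromℚᵘ p) (fromℚᵘ q))
                              (ℚᵘP.+-cong (ℚP.toℚᵘ-fromℚᵘ p) (ℚP.toℚᵘ-fromℚᵘ q)))))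

    fromℚᵘ-* : ∀ p q → fromℚᵘ (p ℚᵘ.* q) ≡ fromℚᵘ p *ℚ fromℚᵘ q
    fromℚᵘ-* p q = ℚP.toℚᵘ-injective (ℚᵘP.≃-trans (ℚP.toℚᵘ-fromℚᵘ (p ℚᵘ.* q))
      (ℚᵘP.≃-sym (ℚᵘP.≃-trans (ℚP.toℚᵘ-homo-* (fromℚᵘ p) (fromℚᵘ q))
                              (ℚᵘP.*-cong (ℚP.toℚᵘ-fromℚᵘ p) (ℚP.toℚᵘ-fromℚᵘ q)))))

    natℚᵘ : ℕ → ℚᵘ
    natℚᵘ n = mkℚᵘ (+ n) 0

    -- mkℚᵘ stores the denominator minus one.
    1/!ᵘ : ℕ → ℚᵘ
    1/!ᵘ n = mkℚᵘ (+ 1) (pred (n !))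

    1/-fromℚᵘ : ∀ d .{{_ : ℕ.NonZero d}} → + 1 / d ≡ fromℚᵘ (mkℚᵘ (+ 1) (pred d))
    1/-fromℚᵘ (suc d) = refl

    1/!-fromℚᵘ : ∀ n → 1/! n ≡ fromℚᵘ (1/!ᵘ n)
    1/!-fromℚᵘ n = 1/-fromℚᵘ (n !) {{n ℕP.!≢0}}

    suc-pred-! : ∀ n → suc (pred (n !)) ≡ n !
    suc-pred-! n = ℕP.suc-pred (n !) {{n ℕP.!≢0}}

    +suc-pred-! : ∀ n → + suc (pred (1 ℕ.* suc (pred (n !)))) ≡ + (n !)
    +suc-pred-! n = cong +_ (begin
      suc (pred (1 ℕ.* suc (pred (n !)))) ≡⟨ cong (λ m → suc (pred m)) (ℕP.*-identityˡ (suc (pred (n !)))) ⟩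
      suc (pred (suc (pred (n !))))       ≡⟨ cong (λ m → suc (pred m)) (suc-pred-! n) ⟩
      suc (pred (n !))                    ≡⟨ suc-pred-! n ⟩
      n !                                 ∎)
      where open ≡.≡-Reasoning

  natℚ-+ : ∀ m n → natℚ (m ℕ.+ n) ≡ natℚ m +ℚ natℚ n
  natℚ-+ m n = trans (ℚP.fromℚᵘ-cong {natℚᵘ (m ℕ.+ n)} {natℚᵘ m ℚᵘ.+ natℚᵘ n} (*≡* eq)) (fromℚᵘ-+ (natℚᵘ m) (natℚᵘ n))
    where
    eq : + (m ℕ.+ n) ℤ.* + 1 ≡ (+ m ℤ.* + 1 ℤ.+ + n ℤ.* + 1) ℤ.* + 1
    eq rewrite ℤP.*-identityʳ (+ m) | ℤP.*-identityʳ (+ n) = cong (ℤ._* + 1) (ℤP.pos-+ m n)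

  natℚ-suc-*-1/! : ∀ n → natℚ (suc n) *ℚ 1/! (suc n) ≡ 1/! n
  natℚ-suc-*-1/! n = begin
    natℚ (suc n) *ℚ 1/! (suc n)                 ≡⟨ cong (natℚ (suc n) *ℚ_) (1/!-fromℚᵘ (suc n)) ⟩
    fromℚᵘ (natℚᵘ (suc n)) *ℚ fromℚᵘ (1/!ᵘ (suc n)) ≡⟨ sym (fromℚᵘ-* (natℚᵘ (suc n)) (1/!ᵘ (suc n))) ⟩
    fromℚᵘ (natℚᵘ (suc n) ℚᵘ.* 1/!ᵘ (suc n))     ≡⟨ ℚP.fromℚᵘ-cong {natℚᵘ (suc n) ℚᵘ.* 1/!ᵘ (suc n)} {1/!ᵘ n} (*≡* eq) ⟩
    fromℚᵘ (1/!ᵘ n)                              ≡⟨ sym (1/!-fromℚᵘ n) ⟩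
    1/! n                                        ∎
    where
    open ≡.≡-Reasoning
    eq : (+ suc n ℤ.* + 1) ℤ.* + suc (pred (n !)) ≡ + 1 ℤ.* + suc (pred (1 ℕ.* suc (pred (suc n !))))
    eq = begin
      (+ suc n ℤ.* + 1) ℤ.* + suc (pred (n !)) ≡⟨ cong₂ ℤ._*_ (ℤP.*-identityʳ (+ suc n)) (cong +_ (suc-pred-! n)) ⟩
      + suc n ℤ.* + (n !)                      ≡⟨ sym (ℤP.pos-* (suc n) (n !)) ⟩
      + (suc n !)                              ≡⟨ sym (+suc-pred-! (suc n)) ⟩
      + suc (pred (1 ℕ.* suc (pred (suc n !)))) ≡⟨ sym (ℤP.*-identityˡ _) ⟩
      + 1 ℤ.* + suc (pred (1 ℕ.* suc (pred (suc n !)))) ∎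

  natℚ-!-*-1/! : ∀ n → natℚ (n !) *ℚ 1/! n ≡ 1ℚ
  natℚ-!-*-1/! n = begin
    natℚ (n !) *ℚ 1/! n                     ≡⟨ cong (natℚ (n !) *ℚ_) (1/!-fromℚᵘ n) ⟩
    fromℚᵘ (natℚᵘ (n !)) *ℚ fromℚᵘ (1/!ᵘ n) ≡⟨ sym (fromℚᵘ-* (natℚᵘ (n !)) (1/!ᵘ n)) ⟩
    fromℚᵘ (natℚᵘ (n !) ℚᵘ.* 1/!ᵘ n)        ≡⟨ ℚP.fromℚᵘ-cong {natℚᵘ (n !) ℚᵘ.* 1/!ᵘ n} {mkℚᵘ (+ 1) 0} (*≡* eq) ⟩
    1ℚ                                      ∎
    where
    open ≡.≡-Reasoning
    eq : (+ (n !) ℤ.* + 1) ℤ.* + 1 ≡ + 1 ℤ.* + suc (pred (1 ℕ.* suc (pred (n !))))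
    eq = begin
      (+ (n !) ℤ.* + 1) ℤ.* + 1                  ≡⟨ ℤP.*-identityʳ _ ⟩
      + (n !) ℤ.* + 1                            ≡⟨ ℤP.*-identityʳ _ ⟩
      + (n !)                                    ≡⟨ sym (+suc-pred-! n) ⟩
      + suc (pred (1 ℕ.* suc (pred (n !))))      ≡⟨ sym (ℤP.*-identityˡ _) ⟩
      + 1 ℤ.* + suc (pred (1 ℕ.* suc (pred (n !)))) ∎

  -- 1/(n+1) = n!/(n+1)!
  natℚ-suc⁻¹ : ℕ → ℚ
  natℚ-suc⁻¹ n = natℚ (n !) *ℚ 1/! (suc n)

  natℚ-suc⁻¹-inverseˡ : ∀ n → natℚ-suc⁻¹ n *ℚ natℚ (suc n) ≡ 1ℚ
  natℚ-suc⁻¹-inverseˡ n = begin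
    (natℚ (n !) *ℚ 1/! (suc n)) *ℚ natℚ (suc n) ≡⟨ ℚP.*-assoc (natℚ (n !)) _ _ ⟩
    natℚ (n !) *ℚ (1/! (suc n) *ℚ natℚ (suc n)) ≡⟨ cong (natℚ (n !) *ℚ_) (trans (ℚP.*-comm (1/! (suc n)) _) (natℚ-suc-*-1/! n)) ⟩
    natℚ (n !) *ℚ 1/! n                         ≡⟨ natℚ-!-*-1/! n ⟩
    1ℚ                                          ∎
    where open ≡.≡-Reasoning

record ℚAlgebra : Set₁ where
  field
    commutativeRing : CommutativeRing 0ℓ 0ℓ
  open CommutativeRing commutativeRing
  infixr 7 _·_
  field
    _·_        : ℚ → Carrier → Carrier
    ·-congˡ    : ∀ c {x y} → x ≈ y → c · x ≈ c · y
    ·-*-assoc  : ∀ c x y → (c · x) * y ≈ c · (x * y)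
    ·-distribˡ : ∀ c x y → c · (x + y) ≈ c · x + c · y
    ·-distribʳ : ∀ c d x → (c +ℚ d) · x ≈ c · x + d · x
    ·-assoc    : ∀ c d x → (c *ℚ d) · x ≈ c · (d · x)
    ·-identity : ∀ x → 1ℚ · x ≈ x

module ℚAlgebraProperties (A : ℚAlgebra) where
  open ℚAlgebra A public
  open CommutativeRing commutativeRing public hiding (zero)
  open Algebra.Properties.Ring ring public using (-‿distribʳ-*; -0#≈0#)
  open Algebra.Properties.Group +-group using (identityʳ-unique; inverseʳ-unique)
  open Relation.Binary.Reasoning.Setoid setoid

  ·-zeroˡ : ∀ x → 0ℚ · x ≈ 0#
  ·-zeroˡ x = identityʳ-unique (0ℚ · x) (0ℚ · x) (sym (·-distribʳ 0ℚ 0ℚ x))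

  ·-zeroʳ : ∀ c → c · 0# ≈ 0#
  ·-zeroʳ c = identityʳ-unique (c · 0#) (c · 0#)
    (sym (trans (·-congˡ c (sym (+-identityʳ 0#))) (·-distribˡ c 0# 0#)))

  *-·-comm : ∀ c x y → x * (c · y) ≈ c · (x * y)
  *-·-comm c x y = trans (*-comm x (c · y)) (trans (·-*-assoc c y x) (·-congˡ c (*-comm y x)))

  ι : ℚ → Carrier
  ι c = c · 1#

  ·≈ι* : ∀ c x → c · x ≈ ι c * x
  ·≈ι* c x = sym (trans (·-*-assoc c 1# x) (·-congˡ c (*-identityˡ x)))

  ι-+ : ∀ c d → ι (c +ℚ d) ≈ ι c + ι d
  ι-+ c d = ·-distribʳ c d 1#

  ι-* : ∀ c d → ι (c *ℚ d) ≈ ι c * ι d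
  ι-* c d = trans (·-assoc c d 1#) (·≈ι* c (ι d))

  ι-0 : ι 0ℚ ≈ 0#
  ι-0 = ·-zeroˡ 1#

  ι-1 : ι 1ℚ ≈ 1#
  ι-1 = ·-identity 1#

  ι-neg : ∀ c → ι (-ℚ c) ≈ - ι c
  ι-neg c = inverseʳ-unique (ι c) (ι (-ℚ c))
    (trans (sym (ι-+ c (-ℚ c))) (trans (reflexive (≡.cong ι (ℚP.+-inverseʳ c))) ι-0))

  ·-cancel-suc : ∀ n {x y} → natℚ (suc n) · x ≈ natℚ (suc n) · y → x ≈ y
  ·-cancel-suc n {x} {y} e = begin
    x                                      ≈⟨ sym (·-identity x) ⟩
    1ℚ · x                                 ≡⟨ ≡.cong (_· x) (≡.sym (natℚ-suc⁻¹-inverseˡ n)) ⟩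
    (natℚ-suc⁻¹ n *ℚ natℚ (suc n)) · x     ≈⟨ ·-assoc _ _ x ⟩
    natℚ-suc⁻¹ n · (natℚ (suc n) · x)      ≈⟨ ·-congˡ _ e ⟩
    natℚ-suc⁻¹ n · (natℚ (suc n) · y)      ≈⟨ sym (·-assoc _ _ y) ⟩
    (natℚ-suc⁻¹ n *ℚ natℚ (suc n)) · y     ≡⟨ ≡.cong (_· y) (natℚ-suc⁻¹-inverseˡ n) ⟩
    1ℚ · y                                 ≈⟨ ·-identity y ⟩
    y                                      ∎
    where open Factorials using (natℚ-suc⁻¹; natℚ-suc⁻¹-inverseˡ)

  almostCommutativeRing : AlmostCommutativeRing 0ℓ 0ℓ
  almostCommutativeRing = fromCommutativeRing commutativeRing

  ι-homomorphism : ℚP.+-*-rawRing -Raw-AlmostCommutative⟶ almostCommutativeRing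
  ι-homomorphism = record
    { ⟦_⟧ = ι ; +-homo = ι-+ ; *-homo = ι-* ; -‿homo = ι-neg ; 0-homo = ι-0 ; 1-homo = ι-1 }

  ι-≟ : (p q : ℚ) → Maybe (ι p ≈ ι q)
  ι-≟ p q with p ℚ.≟ q
  ... | yes p≡q = just (reflexive (≡.cong ι p≡q))
  ... | no _    = nothing

  module RingSolver =
    Algebra.Solver.Ring ℚP.+-*-rawRing almostCommutativeRing ι-homomorphism ι-≟

  NonZeroDivisor : Carrier → Set
  NonZeroDivisor x = ∀ y → x * y ≈ 0# → y ≈ 0#

  NonZeroDivisor-* : ∀ {x y} → NonZeroDivisor x → NonZeroDivisor y → NonZeroDivisor (x * y)
  NonZeroDivisor-* {x} {y} nx ny z h = ny z (nx (y * z) (trans (sym (*-assoc x y z)) h))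

  NonZeroDivisor-resp : ∀ {x y} → x ≈ y → NonZeroDivisor x → NonZeroDivisor y
  NonZeroDivisor-resp e nx z h = nx z (trans (*-congʳ e) h)

  record IsDerivation (δ : Carrier → Carrier) : Set where
    field
      cong-δ    : ∀ {x y} → x ≈ y → δ x ≈ δ y
      δ-+       : ∀ x y → δ (x + y) ≈ δ x + δ y
      δ-·       : ∀ c x → δ (c · x) ≈ c · δ x
      leibniz   : ∀ x y → δ (x * y) ≈ δ x * y + x * δ y

    δ-0 : δ 0# ≈ 0#
    δ-0 = identityʳ-unique (δ 0#) (δ 0#) (trans (sym (δ-+ 0# 0#)) (cong-δ (+-identityʳ 0#)))

    δ-neg : ∀ x → δ (- x) ≈ - δ x
    δ-neg x = inverseʳ-unique (δ x) (δ (- x)) (trans (sym (δ-+ x (- x))) (trans (cong-δ (-‿inverseʳ x)) δ-0))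

  module _ {δ₁ δ₂ δ₃ : Carrier → Carrier} (D₁ : IsDerivation δ₁) (D₂ : IsDerivation δ₂) (D₃ : IsDerivation δ₃) where
    private module I = IsDerivation
    open RingSolver using (solve; _:+_; _:*_; _:=_)

    linearCombination-isDerivation : ∀ a b c → IsDerivation (λ f → a * δ₁ f + b * δ₂ f + c * δ₃ f)
    linearCombination-isDerivation a b c = record
      { cong-δ = λ e → +-cong (+-cong (*-congˡ (I.cong-δ D₁ e)) (*-congˡ (I.cong-δ D₂ e))) (*-congˡ (I.cong-δ D₃ e))
      ; δ-+ = λ x y → trans (+-cong (+-cong (*-congˡ (I.δ-+ D₁ x y)) (*-congˡ (I.δ-+ D₂ x y))) (*-congˡ (I.δ-+ D₃ x y)))
          (solve 9 (λ a b c p q r p' q' r' → a :* (p :+ p') :+ b :* (q :+ q') :+ c :* (r :+ r') :=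
                                               (a :* p :+ b :* q :+ c :* r) :+ (a :* p' :+ b :* q' :+ c :* r')) refl
                 a b c (δ₁ x) (δ₂ x) (δ₃ x) (δ₁ y) (δ₂ y) (δ₃ y))
      ; δ-· = λ k x → trans (+-cong (+-cong (*-congˡ (trans (I.δ-· D₁ k x) (·≈ι* k _)))
                                            (*-congˡ (trans (I.δ-· D₂ k x) (·≈ι* k _))))
                                    (*-congˡ (trans (I.δ-· D₃ k x) (·≈ι* k _))))
          (trans (solve 7 (λ a b c z p q r → a :* (z :* p) :+ b :* (z :* q) :+ c :* (z :* r) := z :* (a :* p :+ b :* q :+ c :* r))
                          refl a b c (ι k) (δ₁ x) (δ₂ x) (δ₃ x))
                 (sym (·≈ι* k _)))
      ; leibniz = λ x y → trans (+-cong (+-cong (*-congˡ (I.leibniz D₁ x y)) (*-congˡ (I.leibniz D₂ x y))) (*-congˡ (I.leibniz D₃ x y)))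
          (solve 11 (λ a b c x y p q r p' q' r' → a :* (p :* y :+ x :* p') :+ b :* (q :* y :+ x :* q') :+ c :* (r :* y :+ x :* r') :=
                      (a :* p :+ b :* q :+ c :* r) :* y :+ x :* (a :* p' :+ b :* q' :+ c :* r')) refl
                 a b c x y (δ₁ x) (δ₂ x) (δ₃ x) (δ₁ y) (δ₂ y) (δ₃ y))
      }

transportℚAlgebra : (A : ℚAlgebra) → let open ℚAlgebraProperties A in
  (_+'_ _*'_ : Carrier → Carrier → Carrier) (-'_ : Carrier → Carrier) (0' 1' : Carrier) →
  (∀ x y → (x +' y) ≈ (x + y)) → (∀ x y → (x *' y) ≈ (x * y)) → (∀ x → (-' x) ≈ (- x)) →
  0' ≈ 0# → 1' ≈ 1# → ℚAlgebra
transportℚAlgebra A _+'_ _*'_ -'_ 0' 1' e+ e* e- e0 e1 = record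
  { commutativeRing = record
    { Carrier = Carrier ; _≈_ = _≈_ ; _+_ = _+'_ ; _*_ = _*'_ ; -_ = -'_ ; 0# = 0' ; 1# = 1'
    ; isCommutativeRing = record
      { isRing = record
        { +-isAbelianGroup = record
          { isGroup = record
            { isMonoid = record
              { isSemigroup = record
                { isMagma = record { isEquivalence = isEquivalence
                                   ; ∙-cong = λ h h' → trans (e+ _ _) (trans (+-cong h h') (sym (e+ _ _))) }
                ; assoc = λ x y z → trans (e+ _ _) (trans (+-congʳ (e+ x y)) (trans (+-assoc x y z)
                           (sym (trans (e+ _ _) (+-congˡ (e+ y z)))))) }
              ; identity = (λ x → trans (e+ _ _) (trans (+-congʳ e0) (+-identityˡ x)))
                         , (λ x → trans (e+ _ _) (trans (+-congˡ e0) (+-identityʳ x))) }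
            ; inverse = (λ x → trans (e+ _ _) (trans (+-congʳ (e- x)) (trans (-‿inverseˡ x) (sym e0))))
                      , (λ x → trans (e+ _ _) (trans (+-congˡ (e- x)) (trans (-‿inverseʳ x) (sym e0))))
            ; ⁻¹-cong = λ h → trans (e- _) (trans (-‿cong h) (sym (e- _))) }
          ; comm = λ x y → trans (e+ x y) (trans (+-comm x y) (sym (e+ y x))) }
        ; *-cong = λ h h' → trans (e* _ _) (trans (*-cong h h') (sym (e* _ _)))
        ; *-assoc = λ x y z → trans (e* _ _) (trans (*-congʳ (e* x y)) (trans (*-assoc x y z)
                           (sym (trans (e* _ _) (*-congˡ (e* y z))))))
        ; *-identity = (λ x → trans (e* _ _) (trans (*-congʳ e1) (*-identityˡ x)))
                     , (λ x → trans (e* _ _) (trans (*-congˡ e1) (*-identityʳ x)))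
        ; distrib = (λ x y z → trans (e* _ _) (trans (*-congˡ (e+ y z)) (trans (distribˡ x y z)
                       (sym (trans (e+ _ _) (+-cong (e* x y) (e* x z)))))))
                  , (λ x y z → trans (e* _ _) (trans (*-congʳ (e+ y z)) (trans (distribʳ x y z)
                       (sym (trans (e+ _ _) (+-cong (e* y x) (e* z x))))))) }
      ; *-comm = λ x y → trans (e* x y) (trans (*-comm x y) (sym (e* y x))) } }
  ; _·_ = _·_
  ; ·-congˡ = ·-congˡ
  ; ·-*-assoc = λ c x y → trans (e* _ _) (trans (·-*-assoc c x y) (·-congˡ c (sym (e* x y))))
  ; ·-distribˡ = λ c x y → trans (·-congˡ c (e+ x y)) (trans (·-distribˡ c x y) (sym (e+ _ _)))
  ; ·-distribʳ = λ c d x → trans (·-distribʳ c d x) (sym (e+ _ _))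
  ; ·-assoc = ·-assoc
  ; ·-identity = ·-identity
  }
  where open ℚAlgebraProperties A

module FiniteSums (A : ℚAlgebra) where
  open ℚAlgebraProperties A
  open Relation.Binary.Reasoning.Setoid setoid

  ∑ : ℕ → (ℕ → Carrier) → Carrier
  ∑ = sumUpTo 0# _+_

  ∑-cong : ∀ n {f g} → (∀ k → k ≤ n → f k ≈ g k) → ∑ n f ≈ ∑ n g
  ∑-cong zero    h = +-congˡ (h 0 z≤n)
  ∑-cong (suc n) h = +-cong (∑-cong n (λ k k≤n → h k (ℕP.m≤n⇒m≤1+n k≤n))) (h (suc n) ℕP.≤-refl)

  ∑-cong′ : ∀ n {f g} → (∀ k → f k ≈ g k) → ∑ n f ≈ ∑ n g
  ∑-cong′ n h = ∑-cong n (λ k _ → h k)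

  ∑-+ : ∀ n f g → ∑ n (λ k → f k + g k) ≈ ∑ n f + ∑ n g
  ∑-+ zero    f g = trans (+-identityˡ _) (sym (+-cong (+-identityˡ _) (+-identityˡ _)))
  ∑-+ (suc n) f g = trans (+-congʳ (∑-+ n f g)) (swap _ _ _ _)
    where
    swap : ∀ a b c d → (a + b) + (c + d) ≈ (a + c) + (b + d)
    swap a b c d = begin
      (a + b) + (c + d) ≈⟨ +-assoc a b (c + d) ⟩
      a + (b + (c + d)) ≈⟨ +-congˡ (sym (+-assoc b c d)) ⟩
      a + ((b + c) + d) ≈⟨ +-congˡ (+-congʳ (+-comm b c)) ⟩
      a + ((c + b) + d) ≈⟨ +-congˡ (+-assoc c b d) ⟩
      a + (c + (b + d)) ≈⟨ sym (+-assoc a c (b + d)) ⟩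
      (a + c) + (b + d) ∎

  ∑-suc : ∀ n f → ∑ (suc n) f ≈ f 0 + ∑ n (λ k → f (suc k))
  ∑-suc zero    f = trans (+-congʳ (+-identityˡ (f 0))) (+-congˡ (sym (+-identityˡ (f 1))))
  ∑-suc (suc n) f = trans (+-congʳ (∑-suc n f)) (+-assoc _ _ _)

  ∑-zero : ∀ n {f} → (∀ k → k ≤ n → f k ≈ 0#) → ∑ n f ≈ 0#
  ∑-zero zero    h = trans (+-identityˡ _) (h 0 z≤n)
  ∑-zero (suc n) h = trans (+-cong (∑-zero n (λ k k≤n → h k (ℕP.m≤n⇒m≤1+n k≤n))) (h (suc n) ℕP.≤-refl))
                           (+-identityˡ 0#)

  ∑-head : ∀ n f → (∀ k → k < n → f (suc k) ≈ 0#) → ∑ n f ≈ f 0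
  ∑-head zero    f h = +-identityˡ (f 0)
  ∑-head (suc n) f h = trans (∑-suc n f) (trans (+-congˡ (∑-zero n (λ k k≤n → h k (s≤s k≤n)))) (+-identityʳ (f 0)))

  ∑-head′ : ∀ n f → (∀ k → f (suc k) ≈ 0#) → ∑ n f ≈ f 0
  ∑-head′ n f h = ∑-head n f (λ k _ → h k)

  ∑-reverse : ∀ n f → ∑ n f ≈ ∑ n (λ k → f (n ∸ k))
  ∑-reverse zero    f = refl
  ∑-reverse (suc n) f = begin
    ∑ n f + f (suc n)                   ≈⟨ +-congʳ (∑-reverse n f) ⟩
    ∑ n (λ k → f (n ∸ k)) + f (suc n)   ≈⟨ +-comm _ _ ⟩
    f (suc n) + ∑ n (λ k → f (n ∸ k))   ≈⟨ sym (∑-suc n (λ k → f (suc n ∸ k))) ⟩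
    ∑ (suc n) (λ k → f (suc n ∸ k))     ∎

  *-∑ : ∀ n c f → c * ∑ n f ≈ ∑ n (λ k → c * f k)
  *-∑ zero    c f = trans (distribˡ c 0# (f 0)) (+-congʳ (zeroʳ c))
  *-∑ (suc n) c f = trans (distribˡ c _ _) (+-congʳ (*-∑ n c f))

  ∑-* : ∀ n c f → ∑ n f * c ≈ ∑ n (λ k → f k * c)
  ∑-* n c f = trans (*-comm _ c) (trans (*-∑ n c f) (∑-cong′ n (λ k → *-comm c (f k))))

  ·-∑ : ∀ n c f → c · ∑ n f ≈ ∑ n (λ k → c · f k)
  ·-∑ zero    c f = trans (·-distribˡ c 0# (f 0)) (+-congʳ (·-zeroʳ c))
  ·-∑ (suc n) c f = trans (·-distribˡ c _ _) (+-congʳ (·-∑ n c f))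

  ∑-triangle : ∀ n (F : ℕ → ℕ → Carrier) →
               ∑ n (λ m → ∑ m (λ k → F k m)) ≈ ∑ n (λ k → ∑ (n ∸ k) (λ j → F k (k ℕ.+ j)))
  ∑-triangle zero    F = refl
  ∑-triangle (suc n) F = begin
    ∑ n (λ m → ∑ m (λ k → F k m)) + ∑ (suc n) (λ k → F k (suc n))
      ≈⟨ +-congʳ (∑-triangle n F) ⟩
    ∑ n (λ k → ∑ (n ∸ k) (λ j → F k (k ℕ.+ j))) + (∑ n (λ k → F k (suc n)) + F (suc n) (suc n))
      ≈⟨ sym (+-assoc _ _ _) ⟩
    (∑ n (λ k → ∑ (n ∸ k) (λ j → F k (k ℕ.+ j))) + ∑ n (λ k → F k (suc n))) + F (suc n) (suc n)
      ≈⟨ +-cong (sym (∑-+ n _ _)) diagonal ⟩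
    ∑ n (λ k → ∑ (n ∸ k) (λ j → F k (k ℕ.+ j)) + F k (suc n)) + ∑ (suc n ∸ suc n) (λ j → F (suc n) (suc n ℕ.+ j))
      ≈⟨ +-congʳ (∑-cong n row) ⟩
    ∑ n (λ k → ∑ (suc n ∸ k) (λ j → F k (k ℕ.+ j))) + ∑ (suc n ∸ suc n) (λ j → F (suc n) (suc n ℕ.+ j)) ∎
    where
    diagonal : F (suc n) (suc n) ≈ ∑ (suc n ∸ suc n) (λ j → F (suc n) (suc n ℕ.+ j))
    diagonal = begin
      F (suc n) (suc n)                             ≡⟨ ≡.cong (F (suc n)) (≡.sym (ℕP.+-identityʳ (suc n))) ⟩
      F (suc n) (suc n ℕ.+ 0)                       ≈⟨ sym (+-identityˡ _) ⟩
      ∑ 0 (λ j → F (suc n) (suc n ℕ.+ j))            ≡⟨ ≡.cong (λ m → ∑ m (λ j → F (suc n) (suc n ℕ.+ j))) (≡.sym (ℕP.n∸n≡0 n)) ⟩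
      ∑ (suc n ∸ suc n) (λ j → F (suc n) (suc n ℕ.+ j)) ∎
    row : ∀ k → k ≤ n → ∑ (n ∸ k) (λ j → F k (k ℕ.+ j)) + F k (suc n) ≈ ∑ (suc n ∸ k) (λ j → F k (k ℕ.+ j))
    row k k≤n = begin
      ∑ (n ∸ k) (λ j → F k (k ℕ.+ j)) + F k (suc n)
        ≡⟨ ≡.cong (λ m → ∑ (n ∸ k) (λ j → F k (k ℕ.+ j)) + F k m)
                  (≡.sym (≡.trans (ℕP.+-suc k (n ∸ k)) (≡.cong suc (ℕP.m+[n∸m]≡n k≤n)))) ⟩
      ∑ (suc (n ∸ k)) (λ j → F k (k ℕ.+ j))
        ≡⟨ ≡.cong (λ m → ∑ m (λ j → F k (k ℕ.+ j))) (≡.sym (ℕP.+-∸-assoc 1 k≤n)) ⟩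
      ∑ (suc n ∸ k) (λ j → F k (k ℕ.+ j)) ∎

  ∑-homomorphism : ∀ (δ : Carrier → Carrier) → δ 0# ≈ 0# → (∀ x y → δ (x + y) ≈ δ x + δ y) →
                   ∀ n f → δ (∑ n f) ≈ ∑ n (λ k → δ (f k))
  ∑-homomorphism δ δ-0 δ-+ zero    f = trans (δ-+ 0# (f 0)) (+-congʳ δ-0)
  ∑-homomorphism δ δ-0 δ-+ (suc n) f = trans (δ-+ _ _) (+-congʳ (∑-homomorphism δ δ-0 δ-+ n f))

module PowerSeries (A : ℚAlgebra) where
  open ℚAlgebraProperties A
  open FiniteSums A
  open Relation.Binary.Reasoning.Setoid setoid

  Series : Set
  Series = ℕ → Carrier

  infix 4 _≐_ _≋_
  _≐_ : Series → Series → Set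
  f ≐ g = ∀ n → f n ≈ g n

  -- Wrapped in a record so that f and g can be inferred from an equality proof.
  record _≋_ (f g : Series) : Set where
    constructor mk≋
    field at : f ≐ g
  open _≋_ public

  infixl 6 _⊕_
  infixl 7 _⊛_
  _⊕_ : Series → Series → Series
  (f ⊕ g) n = f n + g n

  ⊝_ : Series → Series
  (⊝ f) n = - f n

  𝟘 : Series
  𝟘 _ = 0#

  const : Carrier → Series
  const a zero    = a
  const a (suc _) = 0#

  𝟙 : Series
  𝟙 = const 1#

  _⊛_ : Series → Series → Series
  (f ⊛ g) n = ∑ n (λ k → f k * g (n ∸ k))

  _⋆_ : ℚ → Series → Series
  (c ⋆ f) n = c · f n

  ⊛-cong : ∀ {f f' g g'} → f ≐ f' → g ≐ g' → f ⊛ g ≐ f' ⊛ g'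
  ⊛-cong hf hg n = ∑-cong′ n (λ k → *-cong (hf k) (hg (n ∸ k)))

  ⊛-comm : ∀ f g → f ⊛ g ≐ g ⊛ f
  ⊛-comm f g n = trans (∑-reverse n _) (∑-cong n (λ k k≤n →
    trans (*-comm _ _) (*-congʳ (reflexive (≡.cong g (ℕP.m∸[m∸n]≡n k≤n))))))

  ⊛-assoc : ∀ f g h → (f ⊛ g) ⊛ h ≐ f ⊛ (g ⊛ h)
  ⊛-assoc f g h n = begin
    ∑ n (λ m → ∑ m (λ k → f k * g (m ∸ k)) * h (n ∸ m))
      ≈⟨ ∑-cong′ n (λ m → ∑-* m (h (n ∸ m)) _) ⟩
    ∑ n (λ m → ∑ m (λ k → (f k * g (m ∸ k)) * h (n ∸ m)))
      ≈⟨ ∑-triangle n (λ k m → (f k * g (m ∸ k)) * h (n ∸ m)) ⟩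
    ∑ n (λ k → ∑ (n ∸ k) (λ j → (f k * g ((k ℕ.+ j) ∸ k)) * h (n ∸ (k ℕ.+ j))))
      ≈⟨ ∑-cong′ n (λ k → ∑-cong′ (n ∸ k) (λ j → trans (*-assoc _ _ _)
           (*-congˡ (*-cong (reflexive (≡.cong g (ℕP.m+n∸m≡n k j)))
                            (reflexive (≡.cong h (≡.sym (ℕP.∸-+-assoc n k j)))))))) ⟩
    ∑ n (λ k → ∑ (n ∸ k) (λ j → f k * (g j * h ((n ∸ k) ∸ j))))
      ≈⟨ ∑-cong′ n (λ k → sym (*-∑ (n ∸ k) (f k) _)) ⟩
    ∑ n (λ k → f k * ∑ (n ∸ k) (λ j → g j * h ((n ∸ k) ∸ j))) ∎

  const-⊛ : ∀ a f n → (const a ⊛ f) n ≈ a * f n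
  const-⊛ a f n = ∑-head′ n _ (λ k → zeroˡ _)

  ⊛-identityˡ : ∀ f → 𝟙 ⊛ f ≐ f
  ⊛-identityˡ f n = trans (const-⊛ 1# f n) (*-identityˡ (f n))

  ⊛-identityʳ : ∀ f → f ⊛ 𝟙 ≐ f
  ⊛-identityʳ f n = trans (⊛-comm f 𝟙 n) (⊛-identityˡ f n)

  ⊛-distribˡ : ∀ f g h → f ⊛ (g ⊕ h) ≐ f ⊛ g ⊕ f ⊛ h
  ⊛-distribˡ f g h n = trans (∑-cong′ n (λ k → distribˡ _ _ _)) (∑-+ n _ _)

  ⊛-distribʳ : ∀ f g h → (g ⊕ h) ⊛ f ≐ g ⊛ f ⊕ h ⊛ f
  ⊛-distribʳ f g h n = trans (∑-cong′ n (λ k → distribʳ _ _ _)) (∑-+ n _ _)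

  ⋆-⊛ : ∀ c f g → (c ⋆ f) ⊛ g ≐ c ⋆ (f ⊛ g)
  ⋆-⊛ c f g n = trans (∑-cong′ n (λ k → ·-*-assoc c _ _)) (sym (·-∑ n c _))

  ⊛-isCommutativeRing : IsCommutativeRing _≋_ _⊕_ _⊛_ ⊝_ 𝟘 𝟙
  ⊛-isCommutativeRing = record
    { isRing = record
      { +-isAbelianGroup = record
        { isGroup = record
          { isMonoid = record
            { isSemigroup = record
              { isMagma = record
                { isEquivalence = record
                  { refl = mk≋ (λ n → refl) ; sym = λ h → mk≋ (λ n → sym (at h n))
                  ; trans = λ h h' → mk≋ (λ n → trans (at h n) (at h' n)) }
                ; ∙-cong = λ h h' → mk≋ (λ n → +-cong (at h n) (at h' n)) }
              ; assoc = λ f g h → mk≋ (λ n → +-assoc (f n) (g n) (h n)) }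
            ; identity = (λ f → mk≋ (λ n → +-identityˡ (f n))) , (λ f → mk≋ (λ n → +-identityʳ (f n))) }
          ; inverse = (λ f → mk≋ (λ n → -‿inverseˡ (f n))) , (λ f → mk≋ (λ n → -‿inverseʳ (f n)))
          ; ⁻¹-cong = λ h → mk≋ (λ n → -‿cong (at h n)) }
        ; comm = λ f g → mk≋ (λ n → +-comm (f n) (g n)) }
      ; *-cong = λ h h' → mk≋ (⊛-cong (at h) (at h'))
      ; *-assoc = λ f g h → mk≋ (⊛-assoc f g h)
      ; *-identity = (λ f → mk≋ (⊛-identityˡ f)) , (λ f → mk≋ (⊛-identityʳ f))
      ; distrib = (λ f g h → mk≋ (⊛-distribˡ f g h)) , (λ f g h → mk≋ (⊛-distribʳ f g h)) }
    ; *-comm = λ f g → mk≋ (⊛-comm f g) }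

  seriesAlgebra : ℚAlgebra
  seriesAlgebra = record
    { commutativeRing = record { isCommutativeRing = ⊛-isCommutativeRing }
    ; _·_ = _⋆_
    ; ·-congˡ = λ c h → mk≋ (λ n → ·-congˡ c (at h n))
    ; ·-*-assoc = λ c f g → mk≋ (⋆-⊛ c f g)
    ; ·-distribˡ = λ c f g → mk≋ (λ n → ·-distribˡ c (f n) (g n))
    ; ·-distribʳ = λ c d f → mk≋ (λ n → ·-distribʳ c d (f n))
    ; ·-assoc = λ c d f → mk≋ (λ n → ·-assoc c d (f n))
    ; ·-identity = λ f → mk≋ (λ n → ·-identity (f n))
    }

  module SeriesAlgebra = ℚAlgebraProperties seriesAlgebra
    using (IsDerivation; NonZeroDivisor)

  const-cong : ∀ {a b} → a ≈ b → const a ≐ const b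
  const-cong e zero    = e
  const-cong e (suc n) = refl

  const-+ : ∀ a b → const (a + b) ≐ const a ⊕ const b
  const-+ a b zero    = refl
  const-+ a b (suc n) = sym (+-identityˡ 0#)

  const-* : ∀ a b → const (a * b) ≐ const a ⊛ const b
  const-* a b zero    = sym (const-⊛ a (const b) zero)
  const-* a b (suc n) = sym (trans (const-⊛ a (const b) (suc n)) (zeroʳ a))

  const-neg : ∀ a → const (- a) ≐ ⊝ const a
  const-neg a zero    = refl
  const-neg a (suc n) = sym -0#≈0#

  const-· : ∀ c a → const (c · a) ≐ c ⋆ const a
  const-· c a zero    = refl
  const-· c a (suc n) = sym (·-zeroʳ c)

  t : Series
  t zero          = 0#
  t (suc zero)    = 1#
  t (suc (suc _)) = 0#

  t⊛-zero : ∀ f → (t ⊛ f) 0 ≈ 0#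
  t⊛-zero f = trans (+-identityˡ _) (zeroˡ _)

  t⊛-suc : ∀ f n → (t ⊛ f) (suc n) ≈ f n
  t⊛-suc f n = trans (∑-suc n _) (trans (+-cong (zeroˡ _) (∑-head′ n _ (λ k → zeroˡ _)))
                 (trans (+-identityˡ _) (*-identityˡ (f n))))

  ∂ : Series → Series
  ∂ f n = natℚ (suc n) · f (suc n)

  ∂-leibniz : ∀ f g → ∂ (f ⊛ g) ≐ ∂ f ⊛ g ⊕ f ⊛ ∂ g
  ∂-leibniz f g n = begin
    natℚ (suc n) · ∑ (suc n) h                     ≈⟨ ·-∑ (suc n) (natℚ (suc n)) h ⟩
    ∑ (suc n) (λ k → natℚ (suc n) · h k)           ≈⟨ ∑-cong (suc n) (λ k k≤ → trans (reflexive (≡.cong (_· h k) (split k k≤)))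
                                                                                (·-distribʳ _ _ _)) ⟩
    ∑ (suc n) (λ k → natℚ k · h k + natℚ (suc n ∸ k) · h k) ≈⟨ ∑-+ (suc n) _ _ ⟩
    ∑ (suc n) (λ k → natℚ k · h k) + ∑ (suc n) (λ k → natℚ (suc n ∸ k) · h k) ≈⟨ +-cong left right ⟩
    (∂ f ⊛ g) n + (f ⊛ ∂ g) n                      ∎
    where
    h : ℕ → Carrier
    h k = f k * g (suc n ∸ k)
    split : ∀ k → k ≤ suc n → natℚ (suc n) ≡ natℚ k +ℚ natℚ (suc n ∸ k)
    split k k≤ = ≡.trans (≡.cong natℚ (≡.sym (ℕP.m+[n∸m]≡n k≤))) (Factorials.natℚ-+ k (suc n ∸ k))
    left : ∑ (suc n) (λ k → natℚ k · h k) ≈ (∂ f ⊛ g) n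
    left = trans (∑-suc n _) (trans (+-cong (·-zeroˡ (h 0)) (∑-cong′ n (λ k → sym (·-*-assoc _ _ _))))
                                    (+-identityˡ _))
    right : ∑ (suc n) (λ k → natℚ (suc n ∸ k) · h k) ≈ (f ⊛ ∂ g) n
    right = trans (+-congˡ (trans (reflexive (≡.cong (λ m → natℚ m · h (suc n)) (ℕP.n∸n≡0 n))) (·-zeroˡ _)))
      (trans (+-identityʳ _) (∑-cong n (λ k k≤n →
        trans (reflexive (≡.cong (λ m → natℚ m · (f k * g m)) (ℕP.+-∸-assoc 1 k≤n))) (sym (*-·-comm _ _ _)))))

  ∂-isDerivation : SeriesAlgebra.IsDerivation ∂
  ∂-isDerivation = record
    { cong-δ = λ e → mk≋ (λ n → ·-congˡ _ (at e (suc n)))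
    ; δ-+ = λ f g → mk≋ (λ n → ·-distribˡ _ (f (suc n)) (g (suc n)))
    ; δ-· = λ c f → mk≋ (λ n → trans (sym (·-assoc _ c _))
                  (trans (reflexive (≡.cong (_· f (suc n)) (ℚP.*-comm (natℚ (suc n)) c))) (·-assoc c _ _)))
    ; leibniz = λ f g → mk≋ (∂-leibniz f g) }

  ∂-const : ∀ a → ∂ (const a) ≐ 𝟘
  ∂-const a n = ·-zeroʳ _

  ∂-linear-unique : ∀ k f g → ∂ f ≐ const k ⊛ f → ∂ g ≐ const k ⊛ g → f 0 ≈ g 0 → f ≐ g
  ∂-linear-unique k f g ∂f ∂g f0≈g0 zero    = f0≈g0
  ∂-linear-unique k f g ∂f ∂g f0≈g0 (suc n) = ·-cancel-suc n (begin
    ∂ f n              ≈⟨ trans (∂f n) (const-⊛ k f n) ⟩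
    k * f n            ≈⟨ *-congˡ (∂-linear-unique k f g ∂f ∂g f0≈g0 n) ⟩
    k * g n            ≈⟨ sym (trans (∂g n) (const-⊛ k g n)) ⟩
    ∂ g n              ∎)

  -- Coefficient n of 2 m ∂e is 2 m₀ (n+1) e_{n+1} plus terms in e₁ … e_n, while
  -- coefficient n of e f only involves e₀ … e_n; so e vanishes inductively.
  ∂-equation-zero-solution : ∀ m e f → m ⊛ ∂ e ⊕ m ⊛ ∂ e ≐ e ⊛ f → e 0 ≈ 0# →
                             NonZeroDivisor (m 0 + m 0) → e ≐ 𝟘
  ∂-equation-zero-solution m e f equation e₀≈0 nzd = <-rec (λ n → e n ≈ 0#) step
    where
    step : ∀ n → (∀ {k} → k < n → e k ≈ 0#) → e n ≈ 0#
    step zero    _     = e₀≈0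
    step (suc n) below = ·-cancel-suc n (trans (nzd d leading≈0) (sym (·-zeroʳ _)))
      where
      d : Carrier
      d = natℚ (suc n) · e (suc n)
      e⊛f≈0 : (e ⊛ f) n ≈ 0#
      e⊛f≈0 = ∑-zero n (λ k k≤n → trans (*-congʳ (below (s≤s k≤n))) (zeroˡ _))
      m⊛∂e≈m₀d : (m ⊛ ∂ e) n ≈ m 0 * d
      m⊛∂e≈m₀d = ∑-head n _ (λ k k<n → trans (*-congˡ (trans (·-congˡ _ (below (s≤s (lemma k k<n)))) (·-zeroʳ _))) (zeroʳ _))
        where
        lemma : ∀ k → k < n → suc (n ∸ suc k) ≤ n
        lemma k k<n = ≡.subst (_≤ n) (ℕP.+-∸-assoc 1 k<n) (ℕP.m∸n≤m n k)
      leading≈0 : (m 0 + m 0) * d ≈ 0#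
      leading≈0 = trans (distribʳ d (m 0) (m 0)) (trans (sym (+-cong m⊛∂e≈m₀d m⊛∂e≈m₀d)) (trans (equation n) e⊛f≈0))

  coefficientwise : (Carrier → Carrier) → Series → Series
  coefficientwise δ f n = δ (f n)

  coefficientwise-isDerivation : ∀ {δ} → IsDerivation δ → SeriesAlgebra.IsDerivation (coefficientwise δ)
  coefficientwise-isDerivation {δ} D = record
    { cong-δ = λ e → mk≋ (λ n → cong-δ (at e n))
    ; δ-+ = λ f g → mk≋ (λ n → δ-+ (f n) (g n))
    ; δ-· = λ c f → mk≋ (λ n → δ-· c (f n))
    ; leibniz = λ f g → mk≋ (λ n → trans (∑-homomorphism δ δ-0 δ-+ n _)
                                          (trans (∑-cong′ n (λ k → leibniz _ _)) (∑-+ n _ _))) }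
    where open IsDerivation D

  const-nonZeroDivisor : ∀ {c} → NonZeroDivisor c → SeriesAlgebra.NonZeroDivisor (const c)
  const-nonZeroDivisor {c} nzd-c g prod≈0 = mk≋ (λ n → nzd-c (g n) (trans (sym (const-⊛ c g n)) (at prod≈0 n)))

  const+t⊛-nonZeroDivisor : ∀ {c} → NonZeroDivisor c → ∀ h → SeriesAlgebra.NonZeroDivisor (const c ⊕ t ⊛ h)
  const+t⊛-nonZeroDivisor {c} nzd-c h g prod≈0 = mk≋ (<-rec (λ n → g n ≈ 0#) step)
    where
    coefficient : ∀ n → c * g n + (t ⊛ (h ⊛ g)) n ≈ 0#
    coefficient n = trans (+-cong (sym (const-⊛ c g n)) (sym (⊛-assoc t h g n)))
                          (trans (sym (⊛-distribʳ g (const c) (t ⊛ h) n)) (at prod≈0 n))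
    t⊛-vanishes : ∀ n → (∀ {k} → k < n → g k ≈ 0#) → (t ⊛ (h ⊛ g)) n ≈ 0#
    t⊛-vanishes zero    _     = t⊛-zero (h ⊛ g)
    t⊛-vanishes (suc m) below = trans (t⊛-suc (h ⊛ g) m)
      (∑-zero m (λ k _ → trans (*-congˡ (below (s≤s (ℕP.m∸n≤m m k)))) (zeroʳ _)))
    step : ∀ n → (∀ {k} → k < n → g k ≈ 0#) → g n ≈ 0#
    step n below = nzd-c (g n) (trans (sym (+-identityʳ _)) (trans (+-congˡ (sym (t⊛-vanishes n below))) (coefficient n)))

  t-nonZeroDivisor : SeriesAlgebra.NonZeroDivisor t
  t-nonZeroDivisor g prod≈0 = mk≋ (λ n → trans (sym (t⊛-suc g n)) (at prod≈0 (suc n)))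

ℚ-ℚAlgebra : ℚAlgebra
ℚ-ℚAlgebra = record
  { commutativeRing = ℚP.+-*-commutativeRing
  ; _·_ = _*ℚ_
  ; ·-congˡ = λ c → ≡.cong (c *ℚ_)
  ; ·-*-assoc = ℚP.*-assoc
  ; ·-distribˡ = ℚP.*-distribˡ-+
  ; ·-distribʳ = λ c d x → ℚP.*-distribʳ-+ x c d
  ; ·-assoc = ℚP.*-assoc
  ; ·-identity = ℚP.*-identityˡ
  }

-- A Poly is literally a power series in a whose coefficients are power series in x
-- whose coefficients are power series in y, and _*P_ is the iterated Cauchy product.
module Polynomials where

  module Sy   = PowerSeries ℚ-ℚAlgebra
  module Sxy  = PowerSeries Sy.seriesAlgebra
  module Saxy = PowerSeries Sxy.seriesAlgebra
  module Sxy-Algebra = ℚAlgebraProperties Sxy.seriesAlgebra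
  module Saxy-Algebra = ℚAlgebraProperties Saxy.seriesAlgebra

  ≈P⇒≋ : ∀ {p q} → p ≈P q → Saxy._≋_ p q
  ≈P⇒≋ h = Saxy.mk≋ (λ i → Sxy.mk≋ (λ j → Sy.mk≋ (λ k → h i j k)))

  ≋⇒≈P : ∀ {p q} → Saxy._≋_ p q → p ≈P q
  ≋⇒≈P h i j k = Sy.at (Sxy.at (Saxy.at h i) j) k

  private
    sumUpTo-cong : ∀ {B : Set} (z : B) (_⊕_ : B → B → B) n {f g : ℕ → B} →
                   (∀ k → f k ≡ g k) → sumUpTo z _⊕_ n f ≡ sumUpTo z _⊕_ n g
    sumUpTo-cong z _⊕_ zero    h = ≡.cong (z ⊕_) (h 0)
    sumUpTo-cong z _⊕_ (suc n) h = ≡.cong₂ _⊕_ (sumUpTo-cong z _⊕_ n h) (h (suc n))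

    sumUpTo-pointwise : ∀ {B : Set} (z : B) (_⊕_ : B → B → B) n (F : ℕ → ℕ → B) m →
      sumUpTo (λ _ → z) (λ f g x → f x ⊕ g x) n F m ≡ sumUpTo z _⊕_ n (λ i → F i m)
    sumUpTo-pointwise z _⊕_ zero    F m = ≡.refl
    sumUpTo-pointwise z _⊕_ (suc n) F m = ≡.cong (_⊕ F (suc n) m) (sumUpTo-pointwise z _⊕_ n F m)

  *P≋⊛ : ∀ p q → Saxy._≋_ (p *P q) (Saxy._⊛_ p q)
  *P≋⊛ p q = ≈P⇒≋ (λ i j k → ≡.sym (≡.trans
    (≡.cong (λ f → f k) (sumUpTo-pointwise Sy.𝟘 Sy._⊕_ i (λ i₁ → Sxy._⊛_ (p i₁) (q (i ∸ i₁))) j))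
    (≡.trans (sumUpTo-pointwise 0ℚ _+ℚ_ i (λ i₁ → Sxy._⊛_ (p i₁) (q (i ∸ i₁)) j) k)
             (sumUpTo-cong 0ℚ _+ℚ_ i (λ i₁ → sumUpTo-pointwise 0ℚ _+ℚ_ j
                                                 (λ j₁ → Sy._⊛_ (p i₁ j₁) (q (i ∸ i₁) (j ∸ j₁))) k)))))

  1P≈P𝟙 : 1P ≈P Saxy.𝟙
  1P≈P𝟙 zero    zero    zero    = ≡.refl
  1P≈P𝟙 zero    zero    (suc k) = ≡.refl
  1P≈P𝟙 zero    (suc j) k       = ≡.refl
  1P≈P𝟙 (suc i) j       k       = ≡.refl

  polyAlgebra : ℚAlgebra
  polyAlgebra = transportℚAlgebra Saxy.seriesAlgebra _+P_ _*P_ -P_ 0P 1P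
    (λ _ _ → ≈P⇒≋ (λ _ _ _ → ≡.refl)) *P≋⊛ (λ _ → ≈P⇒≋ (λ _ _ _ → ≡.refl))
    (≈P⇒≋ (λ _ _ _ → ≡.refl)) (≈P⇒≋ 1P≈P𝟙)

  module Poly = ℚAlgebraProperties polyAlgebra

  private
    ⊛-derivation⇒*P-derivation : ∀ {δ} → Saxy.SeriesAlgebra.IsDerivation δ → Poly.IsDerivation δ
    ⊛-derivation⇒*P-derivation {δ} D = record
      { cong-δ = cong-δ
      ; δ-+ = δ-+
      ; δ-· = δ-·
      ; leibniz = λ x y → Poly.trans (cong-δ (*P≋⊛ x y)) (Poly.trans (leibniz x y)
          (Poly.sym (Poly.+-cong {δ x *P y} {Saxy._⊛_ (δ x) y} {x *P δ y} {Saxy._⊛_ x (δ y)}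
                                  (*P≋⊛ (δ x) y) (*P≋⊛ x (δ y))))) }
      where open Saxy.SeriesAlgebra.IsDerivation D

  D-isDerivation : Poly.IsDerivation D
  D-isDerivation = Poly.linearCombination-isDerivation
    (⊛-derivation⇒*P-derivation Saxy.∂-isDerivation)
    (⊛-derivation⇒*P-derivation (Saxy.coefficientwise-isDerivation Sxy.∂-isDerivation))
    (⊛-derivation⇒*P-derivation (Saxy.coefficientwise-isDerivation
                                   (Sxy.coefficientwise-isDerivation Sy.∂-isDerivation)))
    (varA *P varX) (varX *P varY) (varX *P varX)

  private
    0* : ∀ n → natℚ n *ℚ 0ℚ ≡ 0ℚ
    0* n = ℚP.*-zeroʳ (natℚ n)

    ∂a-varA : ∂a varA ≈P 1P
    ∂a-varA zero zero zero = ≡.refl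
    ∂a-varA zero zero (suc k) = ≡.refl
    ∂a-varA zero (suc j) k = ≡.refl
    ∂a-varA (suc i) j k = 0* (suc (suc i))

    ∂x-varA : ∂x varA ≈P 0P
    ∂x-varA zero j k = 0* (suc j)
    ∂x-varA (suc zero) zero k = 0* 1
    ∂x-varA (suc zero) (suc j) k = 0* (suc (suc j))
    ∂x-varA (suc (suc i)) j k = 0* (suc j)

    ∂y-varA : ∂y varA ≈P 0P
    ∂y-varA zero j k = 0* (suc k)
    ∂y-varA (suc zero) zero k = 0* (suc k)
    ∂y-varA (suc zero) (suc j) k = 0* (suc k)
    ∂y-varA (suc (suc i)) j k = 0* (suc k)

    ∂a-varX : ∂a varX ≈P 0P
    ∂a-varX i j k = 0* (suc i)

    ∂x-varX : ∂x varX ≈P 1P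
    ∂x-varX zero zero zero = ≡.refl
    ∂x-varX zero zero (suc k) = ≡.refl
    ∂x-varX zero (suc j) k = 0* (suc (suc j))
    ∂x-varX (suc i) zero zero = ≡.refl
    ∂x-varX (suc i) zero (suc k) = ≡.refl
    ∂x-varX (suc i) (suc j) k = 0* (suc (suc j))

    ∂y-varX : ∂y varX ≈P 0P
    ∂y-varX zero zero k = 0* (suc k)
    ∂y-varX zero (suc zero) zero = ≡.refl
    ∂y-varX zero (suc zero) (suc k) = 0* (suc (suc k))
    ∂y-varX zero (suc (suc j)) k = 0* (suc k)
    ∂y-varX (suc i) j k = 0* (suc k)

    ∂a-varY : ∂a varY ≈P 0P
    ∂a-varY i j k = 0* (suc i)

    ∂x-varY : ∂x varY ≈P 0P
    ∂x-varY zero j k = 0* (suc j)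
    ∂x-varY (suc i) j k = 0* (suc j)

    ∂y-varY : ∂y varY ≈P 1P
    ∂y-varY zero zero zero = ≡.refl
    ∂y-varY zero zero (suc k) = 0* (suc (suc k))
    ∂y-varY zero (suc j) zero = ≡.refl
    ∂y-varY zero (suc j) (suc k) = 0* (suc (suc k))
    ∂y-varY (suc i) zero zero = ≡.refl
    ∂y-varY (suc i) zero (suc k) = 0* (suc (suc k))
    ∂y-varY (suc i) (suc j) zero = ≡.refl
    ∂y-varY (suc i) (suc j) (suc k) = 0* (suc (suc k))


  open Poly using (_≈_; _+_; _*_; 0#; 1#)

  -- Poly's operations unfold under unification, so implicit arguments are given explicitly.
  D-by-partials : ∀ f {p q r} → ∂a f ≈P p → ∂x f ≈P q → ∂y f ≈P r →
                  D f ≈ (varA * varX) * p + (varX * varY) * q + (varX * varX) * r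
  D-by-partials f {p} {q} {r} ha hx hy =
    Poly.+-cong {u * ∂a f + v * ∂x f} {u * p + v * q} {w * ∂y f} {w * r}
      (Poly.+-cong {u * ∂a f} {u * p} {v * ∂x f} {v * q}
        (Poly.*-congˡ {u} (≈P⇒≋ ha)) (Poly.*-congˡ {v} (≈P⇒≋ hx)))
      (Poly.*-congˡ {w} (≈P⇒≋ hy))
    where
    u v w : Poly
    u = varA * varX
    v = varX * varY
    w = varX * varX

  private
    [100] : ∀ u v w → u * 1# + v * 0# + w * 0# ≈ u
    [100] u v w = Poly.trans {u * 1# + v * 0# + w * 0#} {u + 0# + 0#}
      (Poly.+-cong {u * 1# + v * 0#} {u + 0#} {w * 0#} {0#}
        (Poly.+-cong {u * 1#} {u} {v * 0#} {0#} (Poly.*-identityʳ u) (Poly.zeroʳ v)) (Poly.zeroʳ w))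
      (Poly.trans {u + 0# + 0#} {u + 0#} (Poly.+-identityʳ (u + 0#)) (Poly.+-identityʳ u))

    [010] : ∀ u v w → u * 0# + v * 1# + w * 0# ≈ v
    [010] u v w = Poly.trans {u * 0# + v * 1# + w * 0#} {0# + v + 0#}
      (Poly.+-cong {u * 0# + v * 1#} {0# + v} {w * 0#} {0#}
        (Poly.+-cong {u * 0#} {0#} {v * 1#} {v} (Poly.zeroʳ u) (Poly.*-identityʳ v)) (Poly.zeroʳ w))
      (Poly.trans {0# + v + 0#} {0# + v} (Poly.+-identityʳ (0# + v)) (Poly.+-identityˡ v))

    [001] : ∀ u v w → u * 0# + v * 0# + w * 1# ≈ w
    [001] u v w = Poly.trans {u * 0# + v * 0# + w * 1#} {0# + 0# + w}
      (Poly.+-cong {u * 0# + v * 0#} {0# + 0#} {w * 1#} {w}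
        (Poly.+-cong {u * 0#} {0#} {v * 0#} {0#} (Poly.zeroʳ u) (Poly.zeroʳ v)) (Poly.*-identityʳ w))
      (Poly.trans {0# + 0# + w} {0# + w} (Poly.+-congʳ {w} {0# + 0#} {0#} (Poly.+-identityʳ 0#)) (Poly.+-identityˡ w))

  D-varA : D varA ≈ varA * varX
  D-varA = Poly.trans (D-by-partials varA ∂a-varA ∂x-varA ∂y-varA) ([100] (varA * varX) (varX * varY) (varX * varX))

  D-varX : D varX ≈ varX * varY
  D-varX = Poly.trans (D-by-partials varX ∂a-varX ∂x-varX ∂y-varX) ([010] (varA * varX) (varX * varY) (varX * varX))

  D-varY : D varY ≈ varX * varX
  D-varY = Poly.trans (D-by-partials varY ∂a-varY ∂x-varY ∂y-varY) ([001] (varA * varX) (varX * varY) (varX * varX))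

  private
    x+y≈P : varX +P varY ≈P Saxy.const (Sxy.const Sy.t Sxy.⊕ Sxy.t)
    x+y≈P zero zero          zero          = ≡.refl
    x+y≈P zero zero          (suc zero)    = ≡.refl
    x+y≈P zero zero          (suc (suc k)) = ≡.refl
    x+y≈P zero (suc zero)    zero          = ≡.refl
    x+y≈P zero (suc zero)    (suc k)       = ≡.refl
    x+y≈P zero (suc (suc j)) k             = ≡.refl
    x+y≈P (suc i) j k                      = ≡.refl

    y-x≈P : varY -P varX ≈P Saxy.const (Sxy.const Sy.t Sxy.⊕ Sxy.⊝ Sxy.t)
    y-x≈P zero zero          zero          = ≡.refl
    y-x≈P zero zero          (suc zero)    = ≡.refl
    y-x≈P zero zero          (suc (suc k)) = ≡.refl
    y-x≈P zero (suc zero)    zero          = ≡.refl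
    y-x≈P zero (suc zero)    (suc k)       = ≡.refl
    y-x≈P zero (suc (suc j)) k             = ≡.refl
    y-x≈P (suc i) j k                      = ≡.refl

    -- The polynomial y + x h; the cases h = ±1 give y ± x.
    y+xh-nonZeroDivisor : ∀ (h : Sxy.Series) →
      Poly.NonZeroDivisor (Saxy.const (Sxy.const Sy.t Sxy.⊕ Sxy.t Sxy.⊛ h))
    y+xh-nonZeroDivisor h q prod≈0 = Saxy.const-nonZeroDivisor
      (Sxy.const+t⊛-nonZeroDivisor Sy.t-nonZeroDivisor h) q
      (Saxy-Algebra.trans {Saxy._⊛_ c q} {c *P q} (Saxy-Algebra.sym (*P≋⊛ c q)) prod≈0)
      where
      c : Poly
      c = Saxy.const (Sxy.const Sy.t Sxy.⊕ Sxy.t Sxy.⊛ h)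

    nonZeroDivisor-resp-≈P : ∀ {p q} → p ≈P q → Poly.NonZeroDivisor q → Poly.NonZeroDivisor p
    nonZeroDivisor-resp-≈P p≈q = Poly.NonZeroDivisor-resp (Poly.sym (≈P⇒≋ p≈q))

  x+y-nonZeroDivisor : Poly.NonZeroDivisor (varX + varY)
  x+y-nonZeroDivisor = nonZeroDivisor-resp-≈P x+y≈P (Poly.NonZeroDivisor-resp
    (Saxy.mk≋ (Saxy.const-cong (Sxy-Algebra.+-congˡ {Sxy.const Sy.t} {Sxy.t Sxy.⊛ Sxy.𝟙} {Sxy.t}
                                                  (Sxy-Algebra.*-identityʳ Sxy.t))))
    (y+xh-nonZeroDivisor Sxy.𝟙))

  y-x-nonZeroDivisor : Poly.NonZeroDivisor (varY -P varX)
  y-x-nonZeroDivisor = nonZeroDivisor-resp-≈P y-x≈P (Poly.NonZeroDivisor-resp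
    (Saxy.mk≋ (Saxy.const-cong (Sxy-Algebra.+-congˡ {Sxy.const Sy.t} {Sxy.t Sxy.⊛ Sxy.⊝ Sxy.𝟙} {Sxy.⊝ Sxy.t}
                                                  (Sxy-Algebra.trans (Sxy-Algebra.sym (Sxy-Algebra.-‿distribʳ-* Sxy.t Sxy.𝟙))
                                                                     (Sxy-Algebra.-‿cong (Sxy-Algebra.*-identityʳ Sxy.t))))))
    (y+xh-nonZeroDivisor (Sxy.⊝ Sxy.𝟙)))

  Δ-nonZeroDivisor : Poly.NonZeroDivisor Δ
  Δ-nonZeroDivisor = Poly.NonZeroDivisor-resp {(varY -P varX) * (varX + varY)} {Δ}
    (solve 2 (λ x y → (y :- x) :* (x :+ y) := y :* y :- x :* x) Poly.refl varX varY)
    (Poly.NonZeroDivisor-* {varY -P varX} {varX + varY} y-x-nonZeroDivisor x+y-nonZeroDivisor)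
    where open Poly.RingSolver using (solve; _:+_; _:*_; _:-_; _:=_)

module QuadraticExtension where
  private
    module P = Polynomials.Poly
    open P.RingSolver using (solve; _:=_; _:+_; _:*_)

  infix 4 _≃R_
  record _≃R_ (u v : R) : Set where
    constructor mk≃
    field
      fst≃ : proj₁ u P.≈ proj₁ v
      snd≃ : proj₂ u P.≈ proj₂ v
  open _≃R_ public

  negR : R → R
  negR (p , q) = -P p , -P q

  _·R_ : ℚ → R → R
  c ·R (p , q) = c P.· p , c P.· q

  private
    *R-cong : ∀ {u u' v v'} → u ≃R u' → v ≃R v' → u *R v ≃R u' *R v'
    *R-cong {p , q} {p' , q'} {r , t} {r' , t'} (mk≃ p≈p' q≈q') (mk≃ r≈r' t≈t') = mk≃
      (P.+-cong {p *P r} {p' *P r'} {(q *P t) *P Δ} {(q' *P t') *P Δ}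
        (P.*-cong {p} {p'} {r} {r'} p≈p' r≈r') (P.*-congʳ {Δ} (P.*-cong {q} {q'} {t} {t'} q≈q' t≈t')))
      (P.+-cong {p *P t} {p' *P t'} {q *P r} {q' *P r'}
        (P.*-cong {p} {p'} {t} {t'} p≈p' t≈t') (P.*-cong {q} {q'} {r} {r'} q≈q' r≈r'))

    *R-assoc : ∀ u v w → (u *R v) *R w ≃R u *R (v *R w)
    *R-assoc (p , q) (p' , q') (p'' , q'') = mk≃
      (solve 7 (λ p q p' q' p'' q'' d → (p :* p' :+ q :* q' :* d) :* p'' :+ (p :* q' :+ q :* p') :* q'' :* d :=
                                        p :* (p' :* p'' :+ q' :* q'' :* d) :+ q :* (p' :* q'' :+ q' :* p'') :* d)
             P.refl p q p' q' p'' q'' Δ)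
      (solve 7 (λ p q p' q' p'' q'' d → (p :* p' :+ q :* q' :* d) :* q'' :+ (p :* q' :+ q :* p') :* p'' :=
                                        p :* (p' :* q'' :+ q' :* p'') :+ q :* (p' :* p'' :+ q' :* q'' :* d))
             P.refl p q p' q' p'' q'' Δ)

    *R-comm : ∀ u v → u *R v ≃R v *R u
    *R-comm (p , q) (p' , q') = mk≃
      (solve 5 (λ p q p' q' d → p :* p' :+ q :* q' :* d := p' :* p :+ q' :* q :* d) P.refl p q p' q' Δ)
      (solve 4 (λ p q p' q' → p :* q' :+ q :* p' := p' :* q :+ q' :* p) P.refl p q p' q')

    *R-distribˡ : ∀ u v w → u *R (v +R w) ≃R (u *R v) +R (u *R w)
    *R-distribˡ (p , q) (p' , q') (p'' , q'') = mk≃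
      (solve 7 (λ p q p' q' p'' q'' d → p :* (p' :+ p'') :+ q :* (q' :+ q'') :* d :=
                                        (p :* p' :+ q :* q' :* d) :+ (p :* p'' :+ q :* q'' :* d))
             P.refl p q p' q' p'' q'' Δ)
      (solve 6 (λ p q p' q' p'' q'' → p :* (q' :+ q'') :+ q :* (p' :+ p'') :=
                                      (p :* q' :+ q :* p') :+ (p :* q'' :+ q :* p''))
             P.refl p q p' q' p'' q'')

    *R-distribʳ : ∀ u v w → (v +R w) *R u ≃R (v *R u) +R (w *R u)
    *R-distribʳ u v w = mk≃
      (P.trans (fst≃ (*R-comm (v +R w) u)) (P.trans (fst≃ (*R-distribˡ u v w))
        (P.+-cong (fst≃ (*R-comm u v)) (fst≃ (*R-comm u w)))))
      (P.trans (snd≃ (*R-comm (v +R w) u)) (P.trans (snd≃ (*R-distribˡ u v w))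
        (P.+-cong (snd≃ (*R-comm u v)) (snd≃ (*R-comm u w)))))

    *R-identityˡ : ∀ u → 1R *R u ≃R u
    *R-identityˡ (p , q) = mk≃
      (P.trans {1P *P p +P (0P *P q) *P Δ} {p +P 0P}
        (P.+-cong {1P *P p} {p} {(0P *P q) *P Δ} {0P} (P.*-identityˡ p)
                  (P.trans {(0P *P q) *P Δ} {0P *P Δ} (P.*-congʳ {Δ} (P.zeroˡ q)) (P.zeroˡ Δ)))
        (P.+-identityʳ p))
      (P.trans {1P *P q +P 0P *P p} {q +P 0P}
        (P.+-cong {1P *P q} {q} {0P *P p} {0P} (P.*-identityˡ q) (P.zeroˡ p))
        (P.+-identityʳ q))

    *R-identityʳ : ∀ u → u *R 1R ≃R u
    *R-identityʳ u = mk≃ (P.trans (fst≃ (*R-comm u 1R)) (fst≃ (*R-identityˡ u)))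
                         (P.trans (snd≃ (*R-comm u 1R)) (snd≃ (*R-identityˡ u)))

    ·R-*R-assoc : ∀ c u v → (c ·R u) *R v ≃R c ·R (u *R v)
    ·R-*R-assoc c (p , q) (p' , q') = mk≃ fst-eq snd-eq
      where
      open Relation.Binary.Reasoning.Setoid P.setoid
      fst-eq : (c P.· p) *P p' +P ((c P.· q) *P q') *P Δ P.≈ c P.· (p *P p' +P (q *P q') *P Δ)
      fst-eq = begin
        (c P.· p) *P p' +P ((c P.· q) *P q') *P Δ
          ≈⟨ P.+-cong {(c P.· p) *P p'} {(P.ι c *P p) *P p'} {((c P.· q) *P q') *P Δ} {((P.ι c *P q) *P q') *P Δ}
               (P.*-congʳ {p'} (P.·≈ι* c p)) (P.*-congʳ {Δ} (P.*-congʳ {q'} (P.·≈ι* c q))) ⟩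
        (P.ι c *P p) *P p' +P ((P.ι c *P q) *P q') *P Δ
          ≈⟨ solve 6 (λ z p q p' q' d → z :* p :* p' :+ z :* q :* q' :* d := z :* (p :* p' :+ q :* q' :* d))
                   P.refl (P.ι c) p q p' q' Δ ⟩
        P.ι c *P (p *P p' +P (q *P q') *P Δ) ≈⟨ P.sym (P.·≈ι* c _) ⟩
        c P.· (p *P p' +P (q *P q') *P Δ) ∎
      snd-eq : (c P.· p) *P q' +P (c P.· q) *P p' P.≈ c P.· (p *P q' +P q *P p')
      snd-eq = begin
        (c P.· p) *P q' +P (c P.· q) *P p'
          ≈⟨ P.+-cong {(c P.· p) *P q'} {(P.ι c *P p) *P q'} {(c P.· q) *P p'} {(P.ι c *P q) *P p'}
               (P.*-congʳ {q'} (P.·≈ι* c p)) (P.*-congʳ {p'} (P.·≈ι* c q)) ⟩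
        (P.ι c *P p) *P q' +P (P.ι c *P q) *P p'
          ≈⟨ solve 5 (λ z p q p' q' → z :* p :* q' :+ z :* q :* p' := z :* (p :* q' :+ q :* p'))
                   P.refl (P.ι c) p q p' q' ⟩
        P.ι c *P (p *P q' +P q *P p') ≈⟨ P.sym (P.·≈ι* c _) ⟩
        c P.· (p *P q' +P q *P p') ∎

  rAlgebra : ℚAlgebra
  rAlgebra = record
    { commutativeRing = record
      { Carrier = R ; _≈_ = _≃R_ ; _+_ = _+R_ ; _*_ = _*R_ ; -_ = negR ; 0# = 0R ; 1# = 1R
      ; isCommutativeRing = record
        { isRing = record
          { +-isAbelianGroup = record
            { isGroup = record
              { isMonoid = record
                { isSemigroup = record
                  { isMagma = record
                    { isEquivalence = record
                      { refl = mk≃ P.refl P.refl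
                      ; sym = λ (mk≃ a b) → mk≃ (P.sym a) (P.sym b)
                      ; trans = λ (mk≃ a b) (mk≃ c d) → mk≃ (P.trans a c) (P.trans b d) }
                    ; ∙-cong = λ (mk≃ a b) (mk≃ c d) → mk≃ (P.+-cong a c) (P.+-cong b d) }
                  ; assoc = λ (p , q) (p' , q') (p'' , q'') → mk≃ (P.+-assoc p p' p'') (P.+-assoc q q' q'') }
                ; identity = (λ (p , q) → mk≃ (P.+-identityˡ p) (P.+-identityˡ q))
                           , (λ (p , q) → mk≃ (P.+-identityʳ p) (P.+-identityʳ q)) }
              ; inverse = (λ (p , q) → mk≃ (P.-‿inverseˡ p) (P.-‿inverseˡ q))
                        , (λ (p , q) → mk≃ (P.-‿inverseʳ p) (P.-‿inverseʳ q))
              ; ⁻¹-cong = λ (mk≃ a b) → mk≃ (P.-‿cong a) (P.-‿cong b) }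
            ; comm = λ (p , q) (p' , q') → mk≃ (P.+-comm p p') (P.+-comm q q') }
          ; *-cong = *R-cong
          ; *-assoc = *R-assoc
          ; *-identity = *R-identityˡ , *R-identityʳ
          ; distrib = *R-distribˡ , *R-distribʳ }
        ; *-comm = *R-comm } }
    ; _·_ = _·R_
    ; ·-congˡ = λ c (mk≃ a b) → mk≃ (P.·-congˡ c a) (P.·-congˡ c b)
    ; ·-*-assoc = ·R-*R-assoc
    ; ·-distribˡ = λ c (p , q) (p' , q') → mk≃ (P.·-distribˡ c p p') (P.·-distribˡ c q q')
    ; ·-distribʳ = λ c d (p , q) → mk≃ (P.·-distribʳ c d p) (P.·-distribʳ c d q)
    ; ·-assoc = λ c d (p , q) → mk≃ (P.·-assoc c d p) (P.·-assoc c d q)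
    ; ·-identity = λ (p , q) → mk≃ (P.·-identity p) (P.·-identity q)
    }

  module R = ℚAlgebraProperties rAlgebra

  poly-cong : ∀ {p q} → p P.≈ q → poly p R.≈ poly q
  poly-cong p≈q = mk≃ p≈q P.refl

  poly-+ : ∀ p q → poly (p +P q) R.≈ poly p +R poly q
  poly-+ p q = mk≃ P.refl (P.sym (P.+-identityʳ 0P))

  poly-* : ∀ p q → poly (p *P q) R.≈ poly p *R poly q
  poly-* p q = mk≃
    (P.sym (P.trans {p *P q +P (0P *P 0P) *P Δ} {p *P q +P 0P}
      (P.+-congˡ {p *P q} {(0P *P 0P) *P Δ} {0P}
        (P.trans {(0P *P 0P) *P Δ} {0P *P Δ} (P.*-congʳ {Δ} (P.zeroˡ 0P)) (P.zeroˡ Δ)))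
      (P.+-identityʳ (p *P q))))
    (P.sym (P.trans {p *P 0P +P 0P *P q} {0P +P 0P}
      (P.+-cong {p *P 0P} {0P} {0P *P q} {0P} (P.zeroʳ p) (P.zeroˡ q)) (P.+-identityʳ 0P)))

  poly-neg : ∀ p → poly (-P p) R.≈ negR (poly p)
  poly-neg p = mk≃ P.refl (P.sym P.-0#≈0#)

  ratR≈ι : ∀ c → ratR c R.≈ R.ι c
  ratR≈ι c = mk≃ (≈P⇒≋ constP≈P) (≈P⇒≋ (λ i j k → ≡.sym (ℚP.*-zeroʳ c)))
    where
    open Polynomials using (≈P⇒≋)
    constP≈P : constP c ≈P (c P.· 1P)
    constP≈P zero    zero    zero    = ≡.sym (ℚP.*-identityʳ c)
    constP≈P zero    zero    (suc k) = ≡.sym (ℚP.*-zeroʳ c)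
    constP≈P zero    (suc j) k       = ≡.sym (ℚP.*-zeroʳ c)
    constP≈P (suc i) j       k       = ≡.sym (ℚP.*-zeroʳ c)

  sR*sR≈Δ : sR *R sR R.≈ poly Δ
  sR*sR≈Δ = mk≃
    (P.trans {0P *P 0P +P (1P *P 1P) *P Δ} {0P +P Δ}
      (P.+-cong {0P *P 0P} {0P} {(1P *P 1P) *P Δ} {Δ} (P.zeroˡ 0P)
        (P.trans {(1P *P 1P) *P Δ} {1P *P Δ} (P.*-congʳ {Δ} (P.*-identityˡ 1P)) (P.*-identityˡ Δ)))
      (P.+-identityˡ Δ))
    (P.trans {0P *P 1P +P 1P *P 0P} {0P +P 0P}
      (P.+-cong {0P *P 1P} {0P} {1P *P 0P} {0P} (P.zeroˡ 1P) (P.zeroʳ 1P)) (P.+-identityʳ 0P))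

  -- (p + 0 s)(q₁ + q₂ s) = p q₁ + p q₂ s, so p acts componentwise.
  poly-nonZeroDivisor : ∀ {p} → P.NonZeroDivisor p → R.NonZeroDivisor (poly p)
  poly-nonZeroDivisor {p} nzd (q₁ , q₂) (mk≃ fst≈0 snd≈0) = mk≃ (nzd q₁ fst-eq) (nzd q₂ snd-eq)
    where
    fst-eq : p *P q₁ P.≈ 0P
    fst-eq = P.trans {p *P q₁} {p *P q₁ +P (0P *P q₂) *P Δ}
      (P.sym (P.trans {p *P q₁ +P (0P *P q₂) *P Δ} {p *P q₁ +P 0P}
        (P.+-congˡ {p *P q₁} {(0P *P q₂) *P Δ} {0P}
          (P.trans {(0P *P q₂) *P Δ} {0P *P Δ} (P.*-congʳ {Δ} (P.zeroˡ q₂)) (P.zeroˡ Δ)))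
        (P.+-identityʳ (p *P q₁))))
      fst≈0
    snd-eq : p *P q₂ P.≈ 0P
    snd-eq = P.trans {p *P q₂} {p *P q₂ +P 0P *P q₁}
      (P.sym (P.trans {p *P q₂ +P 0P *P q₁} {p *P q₂ +P 0P}
        (P.+-congˡ {p *P q₂} {0P *P q₁} {0P} (P.zeroˡ q₁)) (P.+-identityʳ (p *P q₂))))
      snd≈0

-- Dⁿ, rat, pow and constSeries are parameters, constrained by Hypotheses, so that Gen, Num
-- and Den below instantiate definitionally to the series of the statement.
module GeneratingFunction
  (Pol K : ℚAlgebra)
  (poly : ℚAlgebraProperties.Carrier Pol → ℚAlgebraProperties.Carrier K)
  (D : ℚAlgebraProperties.Carrier Pol → ℚAlgebraProperties.Carrier Pol)
  (Dⁿ : ℕ → ℚAlgebraProperties.Carrier Pol → ℚAlgebraProperties.Carrier Pol)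
  (rat : ℚ → ℚAlgebraProperties.Carrier K)
  (pow : ℚAlgebraProperties.Carrier K → ℕ → ℚAlgebraProperties.Carrier K)
  (constSeries : ℚAlgebraProperties.Carrier K → ℕ → ℚAlgebraProperties.Carrier K)
  (a x y δ : ℚAlgebraProperties.Carrier Pol)
  (aK xK yK s : ℚAlgebraProperties.Carrier K)
  where

  private
    module P = ℚAlgebraProperties Pol
  open ℚAlgebraProperties K
  open PowerSeries K using (Series; _≐_; _≋_; mk≋; at; _⊕_; _⊛_; ⊝_; const; ∂; 𝟘)
  private
    module C = PowerSeries K

  egf : P.Carrier → Series
  egf f n = rat (1/! n) * poly (Dⁿ n f)

  expSeries : Carrier → Series
  expSeries c n = rat (1/! n) * pow c n

  scaleSeries : Carrier → Series → Series
  scaleSeries u f n = u * f n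

  two : ℚ
  two = + 2 / 1

  Gen Num Den : Series
  Gen = egf a
  Num = constSeries (yK + s) ⊕ scaleSeries (rat two * xK) (expSeries s)
        ⊕ scaleSeries (yK - s) (expSeries (rat two * s))
  Den = constSeries (poly δ + yK * s) ⊕ scaleSeries (poly δ - yK * s) (expSeries (rat two * s))

  record Hypotheses : Set where
    field
      poly-cong : ∀ {p q} → p P.≈ q → poly p ≈ poly q
      poly-+ : ∀ p q → poly (p P.+ q) ≈ poly p + poly q
      poly-* : ∀ p q → poly (p P.* q) ≈ poly p * poly q
      poly-neg : ∀ p → poly (P.- p) ≈ - poly p
      D-isDerivation : P.IsDerivation D
      Dⁿ-zero : ∀ f → Dⁿ 0 f P.≈ f
      Dⁿ-suc : ∀ n f → Dⁿ (suc n) f P.≈ D (Dⁿ n f)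
      rat≈ι : ∀ c → rat c ≈ ι c
      pow-zero : ∀ u → pow u 0 ≈ 1#
      pow-suc : ∀ u n → pow u (suc n) ≈ pow u n * u
      constSeries≈const : ∀ u n → constSeries u n ≈ const u n
      D-a : D a P.≈ a P.* x
      D-x : D x P.≈ x P.* y
      D-y : D y P.≈ x P.* x
      δ≈y²-x² : δ P.≈ y P.* y P.- x P.* x
      aK≈ : aK ≈ poly a
      xK≈ : xK ≈ poly x
      yK≈ : yK ≈ poly y
      s²≈δ : s * s ≈ poly δ
      x+y-nonZeroDivisor : NonZeroDivisor (poly (x P.+ y))
      δ-nonZeroDivisor : NonZeroDivisor (poly δ)

  module _ (H : Hypotheses) where
    open Hypotheses H
    open P.IsDerivation D-isDerivation

    Dⁿ-cong : ∀ n {f g} → f P.≈ g → Dⁿ n f P.≈ Dⁿ n g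
    Dⁿ-cong zero    {f} {g} e = P.trans (Dⁿ-zero f) (P.trans e (P.sym (Dⁿ-zero g)))
    Dⁿ-cong (suc n) {f} {g} e = P.trans (Dⁿ-suc n f) (P.trans (cong-δ (Dⁿ-cong n e)) (P.sym (Dⁿ-suc n g)))

    Dⁿ-suc′ : ∀ n f → Dⁿ (suc n) f P.≈ Dⁿ n (D f)
    Dⁿ-suc′ zero    f = P.trans (Dⁿ-suc 0 f) (P.trans (cong-δ (Dⁿ-zero f)) (P.sym (Dⁿ-zero (D f))))
    Dⁿ-suc′ (suc n) f = P.trans (Dⁿ-suc (suc n) f) (P.trans (cong-δ (Dⁿ-suc′ n f)) (P.sym (Dⁿ-suc n (D f))))

    Dⁿ-+ : ∀ n f g → Dⁿ n (f P.+ g) P.≈ Dⁿ n f P.+ Dⁿ n g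
    Dⁿ-+ zero    f g = P.trans (Dⁿ-zero _) (P.sym (P.+-cong (Dⁿ-zero f) (Dⁿ-zero g)))
    Dⁿ-+ (suc n) f g = P.trans (Dⁿ-suc n _) (P.trans (cong-δ (Dⁿ-+ n f g))
                         (P.trans (δ-+ _ _) (P.sym (P.+-cong (Dⁿ-suc n f) (Dⁿ-suc n g)))))

    Dⁿ-neg : ∀ n f → Dⁿ n (P.- f) P.≈ P.- Dⁿ n f
    Dⁿ-neg zero    f = P.trans (Dⁿ-zero _) (P.-‿cong (P.sym (Dⁿ-zero f)))
    Dⁿ-neg (suc n) f = P.trans (Dⁿ-suc n _) (P.trans (cong-δ (Dⁿ-neg n f))
                         (P.trans (δ-neg _) (P.-‿cong (P.sym (Dⁿ-suc n f)))))

    Dⁿ-constant : ∀ n k → D k P.≈ P.0# → Dⁿ (suc n) k P.≈ P.0#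
    Dⁿ-constant zero    k Dk≈0 = P.trans (Dⁿ-suc 0 k) (P.trans (cong-δ (Dⁿ-zero k)) Dk≈0)
    Dⁿ-constant (suc n) k Dk≈0 = P.trans (Dⁿ-suc (suc n) k) (P.trans (cong-δ (Dⁿ-constant n k Dk≈0)) δ-0)

    poly-0 : poly P.0# ≈ 0#
    poly-0 = x+x≈x⇒x≈0 (poly P.0#) (trans (sym (poly-+ P.0# P.0#)) (poly-cong (P.+-identityʳ P.0#)))
      where open Algebra.Properties.Ring ring using (x+x≈x⇒x≈0)

    rat-* : ∀ c u → rat c * u ≈ c · u
    rat-* c u = trans (*-congʳ (rat≈ι c)) (sym (·≈ι* c u))

    rat-1/!-0 : rat (1/! 0) ≈ 1#
    rat-1/!-0 = trans (rat≈ι 1ℚ) ι-1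

    natℚ-suc·rat-1/!-suc : ∀ n u → natℚ (suc n) · (rat (1/! (suc n)) * u) ≈ rat (1/! n) * u
    natℚ-suc·rat-1/!-suc n u = begin
      natℚ (suc n) · (rat (1/! (suc n)) * u)  ≈⟨ ·-congˡ _ (rat-* _ u) ⟩
      natℚ (suc n) · (1/! (suc n) · u)        ≈⟨ sym (·-assoc _ _ u) ⟩
      (natℚ (suc n) *ℚ 1/! (suc n)) · u       ≡⟨ ≡.cong (_· u) (Factorials.natℚ-suc-*-1/! n) ⟩
      1/! n · u                               ≈⟨ sym (rat-* _ u) ⟩
      rat (1/! n) * u                         ∎
      where open Relation.Binary.Reasoning.Setoid setoid

    egf-cong : ∀ {f g} → f P.≈ g → egf f ≐ egf g
    egf-cong e n = *-congˡ (poly-cong (Dⁿ-cong n e))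

    egf-+ : ∀ f g → egf (f P.+ g) ≐ egf f ⊕ egf g
    egf-+ f g n = trans (*-congˡ (trans (poly-cong (Dⁿ-+ n f g)) (poly-+ _ _))) (distribˡ _ _ _)

    egf-neg : ∀ f → egf (P.- f) ≐ ⊝ egf f
    egf-neg f n = trans (*-congˡ (trans (poly-cong (Dⁿ-neg n f)) (poly-neg _))) (sym (-‿distribʳ-* _ _))

    egf-zero : ∀ f → egf f 0 ≈ poly f
    egf-zero f = trans (*-cong rat-1/!-0 (poly-cong (Dⁿ-zero f))) (*-identityˡ _)

    egf-constant : ∀ k → D k P.≈ P.0# → egf k ≐ const (poly k)
    egf-constant k Dk≈0 zero    = egf-zero k
    egf-constant k Dk≈0 (suc n) = trans (*-congˡ (trans (poly-cong (Dⁿ-constant n k Dk≈0)) poly-0)) (zeroʳ _)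

    ∂-egf : ∀ f → ∂ (egf f) ≐ egf (D f)
    ∂-egf f n = trans (natℚ-suc·rat-1/!-suc n _) (*-congˡ (poly-cong (Dⁿ-suc′ n f)))

    -- Leibniz's rule for D matches the one for ∂, and the constant terms agree.
    egf-* : ∀ f g → egf (f P.* g) ≐ egf f ⊛ egf g
    egf-* f g zero = begin
      egf (f P.* g) 0             ≈⟨ egf-zero _ ⟩
      poly (f P.* g)              ≈⟨ poly-* f g ⟩
      poly f * poly g             ≈⟨ sym (*-cong (egf-zero f) (egf-zero g)) ⟩
      egf f 0 * egf g 0           ≈⟨ sym (+-identityˡ _) ⟩
      (egf f ⊛ egf g) 0           ∎
      where open Relation.Binary.Reasoning.Setoid setoid
    egf-* f g (suc n) = ·-cancel-suc n (begin
      ∂ (egf (f P.* g)) n                            ≈⟨ ∂-egf (f P.* g) n ⟩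
      egf (D (f P.* g)) n                            ≈⟨ egf-cong (leibniz f g) n ⟩
      egf (D f P.* g P.+ f P.* D g) n                ≈⟨ egf-+ _ _ n ⟩
      egf (D f P.* g) n + egf (f P.* D g) n          ≈⟨ +-cong (egf-* (D f) g n) (egf-* f (D g) n) ⟩
      (egf (D f) ⊛ egf g) n + (egf f ⊛ egf (D g)) n  ≈⟨ sym (+-cong (C.⊛-cong {g = egf g} (∂-egf f) (λ _ → refl) n)
                                                                    (C.⊛-cong {f = egf f} (λ _ → refl) (∂-egf g) n)) ⟩
      (∂ (egf f) ⊛ egf g) n + (egf f ⊛ ∂ (egf g)) n  ≈⟨ sym (C.∂-leibniz (egf f) (egf g) n) ⟩
      ∂ (egf f ⊛ egf g) n                            ∎)
      where open Relation.Binary.Reasoning.Setoid setoid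

    -- An opaque copy of _⊛_: the ring solver then compares normal forms
    -- without unfolding Cauchy products.
    opaque
      infixl 7 _⊠_
      _⊠_ : Series → Series → Series
      _⊠_ = _⊛_

    opaque
      unfolding _⊠_
      ⊠≐⊛ : ∀ f g → f ⊠ g ≐ f ⊛ g
      ⊠≐⊛ f g n = refl

    seriesAlgebra : ℚAlgebra
    seriesAlgebra = transportℚAlgebra C.seriesAlgebra _⊕_ _⊠_ ⊝_ 𝟘 C.𝟙
      (λ _ _ → mk≋ (λ _ → refl)) (λ f g → mk≋ (⊠≐⊛ f g)) (λ _ → mk≋ (λ _ → refl))
      (mk≋ (λ _ → refl)) (mk≋ (λ _ → refl))

    module S = ℚAlgebraProperties seriesAlgebra
    private
      module SR = Relation.Binary.Reasoning.Setoid S.setoid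

    const-⊠ : ∀ k f n → (const k ⊠ f) n ≈ k * f n
    const-⊠ k f n = trans (⊠≐⊛ (const k) f n) (C.const-⊛ k f n)

    ∂-isDerivation : S.IsDerivation ∂
    ∂-isDerivation = record
      { cong-δ = ∂.cong-δ ; δ-+ = ∂.δ-+ ; δ-· = ∂.δ-·
      ; leibniz = λ f g → mk≋ (λ n → trans (·-congˡ _ (⊠≐⊛ f g (suc n))) (trans (C.∂-leibniz f g n)
                    (sym (+-cong (⊠≐⊛ (∂ f) g n) (⊠≐⊛ f (∂ g) n))))) }
      where module ∂ = C.SeriesAlgebra.IsDerivation C.∂-isDerivation
    module ∂ = S.IsDerivation ∂-isDerivation

    const≋-cong : ∀ {u v} → u ≈ v → const u ≋ const v
    const≋-cong e = mk≋ (C.const-cong e)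

    const≋-+ : ∀ u v → const (u + v) ≋ const u ⊕ const v
    const≋-+ u v = mk≋ (C.const-+ u v)

    const≋-* : ∀ u v → const (u * v) ≋ const u ⊠ const v
    const≋-* u v = mk≋ (λ n → trans (C.const-* u v n) (sym (⊠≐⊛ (const u) (const v) n)))

    const≋-neg : ∀ u → const (- u) ≋ ⊝ const u
    const≋-neg u = mk≋ (C.const-neg u)

    const≋-ι : ∀ c → const (ι c) ≋ S.ι c
    const≋-ι c = mk≋ (C.const-· c 1#)

    ∂-const≋ : ∀ u → ∂ (const u) ≋ 𝟘
    ∂-const≋ u = mk≋ (C.∂-const u)

    ∂-const⊠ : ∀ u f → ∂ (const u ⊠ f) ≋ const u ⊠ ∂ f
    ∂-const⊠ u f = S.trans (∂.leibniz (const u) f)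
      (S.trans (S.+-congʳ (S.trans (S.*-congʳ (∂-const≋ u)) (S.zeroˡ f))) (S.+-identityˡ _))

    constSeries≋const : ∀ u → constSeries u ≋ const u
    constSeries≋const u = mk≋ (constSeries≈const u)

    scaleSeries≋const⊠ : ∀ u f → scaleSeries u f ≋ const u ⊠ f
    scaleSeries≋const⊠ u f = mk≋ (λ n → sym (const-⊠ u f n))

    expSeries-zero : ∀ c → expSeries c 0 ≈ 1#
    expSeries-zero c = trans (*-cong rat-1/!-0 (pow-zero c)) (*-identityˡ _)

    expSeries-cong : ∀ {c d} → c ≈ d → expSeries c ≋ expSeries d
    expSeries-cong {c} {d} c≈d = mk≋ (λ n → *-congˡ (pow-cong n))
      where
      pow-cong : ∀ n → pow c n ≈ pow d n
      pow-cong zero    = trans (pow-zero c) (sym (pow-zero d))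
      pow-cong (suc n) = trans (pow-suc c n) (trans (*-cong (pow-cong n) c≈d) (sym (pow-suc d n)))

    ∂-expSeries : ∀ c → ∂ (expSeries c) ≐ const c ⊛ expSeries c
    ∂-expSeries c n = begin
      natℚ (suc n) · (rat (1/! (suc n)) * pow c (suc n)) ≈⟨ natℚ-suc·rat-1/!-suc n _ ⟩
      rat (1/! n) * pow c (suc n)                         ≈⟨ *-congˡ (trans (pow-suc c n) (*-comm _ c)) ⟩
      rat (1/! n) * (c * pow c n)                         ≈⟨ x∙yz≈y∙xz _ c _ ⟩
      c * expSeries c n                                   ≈⟨ sym (C.const-⊛ c (expSeries c) n) ⟩
      (const c ⊛ expSeries c) n                           ∎
      where
      open Relation.Binary.Reasoning.Setoid setoid
      open import Algebra.Properties.CommutativeSemigroup *-commutativeSemigroup using (x∙yz≈y∙xz)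

    expSeries-+ : ∀ c d → expSeries c ⊠ expSeries d ≋ expSeries (c + d)
    expSeries-+ c d = mk≋ (λ n → trans (⊠≐⊛ E F n)
      (C.∂-linear-unique (c + d) (E ⊛ F) (expSeries (c + d)) ∂-product (∂-expSeries (c + d)) initial n))
      where
      E F : Series
      E = expSeries c
      F = expSeries d
      ∂-product≋ : ∂ (E ⊠ F) ≋ const (c + d) ⊠ (E ⊠ F)
      ∂-product≋ = begin
        ∂ (E ⊠ F)                                 ≈⟨ ∂.leibniz E F ⟩
        ∂ E ⊠ F ⊕ E ⊠ ∂ F                         ≈⟨ S.+-cong (S.*-congʳ (∂-exp≋ c)) (S.*-congˡ (∂-exp≋ d)) ⟩
        (const c ⊠ E) ⊠ F ⊕ E ⊠ (const d ⊠ F)     ≈⟨ solve 4 (λ kc kd e f → (kc :* e) :* f :+ e :* (kd :* f)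
                                                                    := (kc :+ kd) :* (e :* f)) S.refl (const c) (const d) E F ⟩
        (const c ⊕ const d) ⊠ (E ⊠ F)             ≈⟨ S.*-congʳ (S.sym (const≋-+ c d)) ⟩
        const (c + d) ⊠ (E ⊠ F)                   ∎
        where
        open SR
        open S.RingSolver using (solve; _:+_; _:*_; _:=_)
        ∂-exp≋ : ∀ c → ∂ (expSeries c) ≋ const c ⊠ expSeries c
        ∂-exp≋ c = mk≋ (λ n → trans (∂-expSeries c n) (sym (⊠≐⊛ (const c) (expSeries c) n)))
      ∂-product : ∂ (E ⊛ F) ≐ const (c + d) ⊛ (E ⊛ F)
      ∂-product n = trans (·-congˡ _ (sym (⊠≐⊛ E F (suc n)))) (trans (at ∂-product≋ n)
                      (trans (⊠≐⊛ (const (c + d)) (E ⊠ F) n) (C.⊛-cong (λ _ → refl) (⊠≐⊛ E F) n)))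
      initial : (E ⊛ F) 0 ≈ expSeries (c + d) 0
      initial = trans (+-identityˡ _) (trans (*-cong (expSeries-zero c) (expSeries-zero d))
                  (trans (*-identityˡ _) (sym (expSeries-zero (c + d)))))

    w : P.Carrier
    w = x P.+ y

    D-w : D w P.≈ x P.* w
    D-w = P.trans (δ-+ x y) (P.trans (P.+-cong D-x D-y)
            (solve 2 (λ x y → x :* y :+ x :* x := x :* (x :+ y)) P.refl x y))
      where open P.RingSolver using (solve; _:+_; _:*_; _:=_)

    riccati-w : D w P.+ D w P.≈ w P.* w P.- δ
    riccati-w = begin
      D w P.+ D w                   ≈⟨ P.+-cong D-w D-w ⟩
      x P.* w P.+ x P.* w           ≈⟨ solve 2 (λ x y → x :* (x :+ y) :+ x :* (x :+ y)
                                                     := (x :+ y) :* (x :+ y) :- (y :* y :- x :* x)) P.refl x y ⟩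
      w P.* w P.- (y P.* y P.- x P.* x) ≈⟨ P.+-congˡ (P.-‿cong (P.sym δ≈y²-x²)) ⟩
      w P.* w P.- δ                 ∎
      where
      open Relation.Binary.Reasoning.Setoid P.setoid
      open P.RingSolver using (solve; _:+_; _:*_; _:-_; _:=_)

    D-δ : D δ P.≈ P.0#
    D-δ = begin
      D δ                                                   ≈⟨ cong-δ δ≈y²-x² ⟩
      D (y P.* y P.- x P.* x)                               ≈⟨ P.trans (δ-+ _ _) (P.+-congˡ (δ-neg _)) ⟩
      D (y P.* y) P.- D (x P.* x)                           ≈⟨ P.+-cong (leibniz y y) (P.-‿cong (leibniz x x)) ⟩
      (D y P.* y P.+ y P.* D y) P.- (D x P.* x P.+ x P.* D x)
        ≈⟨ P.+-cong (P.+-cong (P.*-congʳ D-y) (P.*-congˡ D-y)) (P.-‿cong (P.+-cong (P.*-congʳ D-x) (P.*-congˡ D-x))) ⟩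
      ((x P.* x) P.* y P.+ y P.* (x P.* x)) P.- ((x P.* y) P.* x P.+ x P.* (x P.* y))
        ≈⟨ solve 2 (λ x y → ((x :* x) :* y :+ y :* (x :* x)) :- ((x :* y) :* x :+ x :* (x :* y)) := con 0ℚ) P.refl x y ⟩
      P.ι 0ℚ                                                ≈⟨ P.ι-0 ⟩
      P.0#                                                  ∎
      where
      open Relation.Binary.Reasoning.Setoid P.setoid
      open P.RingSolver using (solve; _:+_; _:*_; _:-_; _:=_; con)

    -- Both a and w satisfy D u = x u, and this is what carries the identity from n to n + 1.
    Dⁿa*w : ∀ n → Dⁿ n a P.* w P.≈ a P.* Dⁿ n w
    Dⁿa*w zero    = P.trans (P.*-congʳ (Dⁿ-zero a)) (P.*-congˡ (P.sym (Dⁿ-zero w)))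
    Dⁿa*w (suc n) = begin
      Dⁿ (suc n) a P.* w                            ≈⟨ P.*-congʳ (Dⁿ-suc n a) ⟩
      D A P.* w                                     ≈⟨ solve 3 (λ u v z → u :* z := (u :* z :+ v) :- v) P.refl (D A) (A P.* D w) w ⟩
      (D A P.* w P.+ A P.* D w) P.- A P.* D w       ≈⟨ P.+-cong (P.sym (leibniz A w)) (P.-‿cong (P.*-congˡ D-w)) ⟩
      D (A P.* w) P.- A P.* (x P.* w)               ≈⟨ P.+-cong (cong-δ (Dⁿa*w n))
                                                        (P.-‿cong (solve 3 (λ p x w → p :* (x :* w) := x :* (p :* w)) P.refl A x w)) ⟩
      D (a P.* B) P.- x P.* (A P.* w)               ≈⟨ P.+-cong (leibniz a B) (P.-‿cong (P.*-congˡ (Dⁿa*w n))) ⟩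
      (D a P.* B P.+ a P.* D B) P.- x P.* (a P.* B) ≈⟨ P.+-congʳ (P.+-congʳ (P.*-congʳ D-a)) ⟩
      ((a P.* x) P.* B P.+ a P.* D B) P.- x P.* (a P.* B)
        ≈⟨ solve 4 (λ a x q dq → ((a :* x) :* q :+ a :* dq) :- x :* (a :* q) := a :* dq) P.refl a x B (D B) ⟩
      a P.* D B                                     ≈⟨ P.*-congˡ (P.sym (Dⁿ-suc n w)) ⟩
      a P.* Dⁿ (suc n) w                            ∎
      where
      open Relation.Binary.Reasoning.Setoid P.setoid
      open P.RingSolver using (solve; _:+_; _:*_; _:-_; _:=_)
      A B : P.Carrier
      A = Dⁿ n a
      B = Dⁿ n w

    egf≋-* : ∀ f g → egf (f P.* g) ≋ egf f ⊠ egf g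
    egf≋-* f g = mk≋ (λ n → trans (egf-* f g n) (sym (⊠≐⊛ (egf f) (egf g) n)))

    W : Series
    W = egf w

    riccati-W : ∂ W ⊕ ∂ W ≋ W ⊠ W ⊕ ⊝ const (poly δ)
    riccati-W = begin
      ∂ W ⊕ ∂ W                    ≈⟨ S.+-cong (mk≋ (∂-egf w)) (mk≋ (∂-egf w)) ⟩
      egf (D w) ⊕ egf (D w)        ≈⟨ S.sym (mk≋ (egf-+ (D w) (D w))) ⟩
      egf (D w P.+ D w)            ≈⟨ mk≋ (egf-cong riccati-w) ⟩
      egf (w P.* w P.+ P.- δ)      ≈⟨ mk≋ (egf-+ _ _) ⟩
      egf (w P.* w) ⊕ egf (P.- δ)  ≈⟨ S.+-cong (egf≋-* w w) (mk≋ (egf-neg δ)) ⟩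
      W ⊠ W ⊕ ⊝ egf δ              ≈⟨ S.+-congˡ (S.-‿cong (mk≋ (egf-constant δ D-δ))) ⟩
      W ⊠ W ⊕ ⊝ const (poly δ)     ∎
      where open SR

    Gen⊠w≋aK⊠W : Gen ⊠ const (poly w) ≋ const aK ⊠ W
    Gen⊠w≋aK⊠W = S.trans (S.*-comm Gen (const (poly w))) (mk≋ (λ n → begin
      (const (poly w) ⊠ Gen) n                   ≈⟨ const-⊠ (poly w) Gen n ⟩
      poly w * (rat (1/! n) * poly (Dⁿ n a))     ≈⟨ solve 3 (λ pw r pa → pw :* (r :* pa) := r :* (pa :* pw))
                                                            refl (poly w) (rat (1/! n)) (poly (Dⁿ n a)) ⟩
      rat (1/! n) * (poly (Dⁿ n a) * poly w)     ≈⟨ *-congˡ (sym (poly-* _ _)) ⟩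
      rat (1/! n) * poly (Dⁿ n a P.* w)          ≈⟨ *-congˡ (poly-cong (Dⁿa*w n)) ⟩
      rat (1/! n) * poly (a P.* Dⁿ n w)          ≈⟨ *-congˡ (poly-* _ _) ⟩
      rat (1/! n) * (poly a * poly (Dⁿ n w))     ≈⟨ solve 3 (λ r pa q → r :* (pa :* q) := pa :* (r :* q))
                                                            refl (rat (1/! n)) (poly a) (poly (Dⁿ n w)) ⟩
      poly a * W n                               ≈⟨ *-congʳ (sym aK≈) ⟩
      aK * W n                                   ≈⟨ sym (const-⊠ aK W n) ⟩
      (const aK ⊠ W) n                           ∎))
      where
      open Relation.Binary.Reasoning.Setoid setoid
      open RingSolver using (solve; _:*_; _:=_)

    σ X Y e δ′ two′ : Series
    σ = const s
    X = const xK
    Y = const yK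
    e = expSeries s
    δ′ = const (poly δ)
    two′ = S.ι two

    e²≋ : expSeries (rat two * s) ≋ e ⊠ e
    e²≋ = S.trans (expSeries-cong two*s≈s+s) (S.sym (expSeries-+ s s))
      where
      two*s≈s+s : rat two * s ≈ s + s
      two*s≈s+s = trans (rat-* two s) (trans (·-distribʳ 1ℚ 1ℚ s) (+-cong (·-identity s) (·-identity s)))

    δ′≋σ² : δ′ ≋ σ ⊠ σ
    δ′≋σ² = S.trans (const≋-cong (sym s²≈δ)) (const≋-* s s)

    σ²≋Y²-X² : σ ⊠ σ ≋ Y ⊠ Y ⊕ ⊝ (X ⊠ X)
    σ²≋Y²-X² = S.trans (S.sym (const≋-* s s)) (S.trans (const≋-cong s²≈y²-x²)
      (S.trans (const≋-+ _ _) (S.+-cong (const≋-* yK yK) (S.trans (const≋-neg _) (S.-‿cong (const≋-* xK xK))))))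
      where
      s²≈y²-x² : s * s ≈ yK * yK - xK * xK
      s²≈y²-x² = trans s²≈δ (trans (poly-cong δ≈y²-x²) (trans (poly-+ _ _)
        (+-cong (trans (poly-* y y) (sym (*-cong yK≈ yK≈)))
                (trans (poly-neg _) (-‿cong (trans (poly-* x x) (sym (*-cong xK≈ xK≈))))))))

    private
      const-y+s : const (yK + s) ≋ Y ⊕ σ
      const-y+s = const≋-+ yK s

      const-y-s : const (yK - s) ≋ Y ⊕ ⊝ σ
      const-y-s = S.trans (const≋-+ yK (- s)) (S.+-congˡ (const≋-neg s))

      const-2x : const (rat two * xK) ≋ two′ ⊠ X
      const-2x = S.trans (const≋-* (rat two) xK) (S.*-congʳ (S.trans (const≋-cong (rat≈ι two)) (const≋-ι two)))

      const-δ+ : ∀ {u v} → const u ≋ v → const (poly δ + u) ≋ σ ⊠ σ ⊕ v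
      const-δ+ h = S.trans (const≋-+ _ _) (S.+-cong δ′≋σ² h)

      ∂e≋ : ∂ e ≋ σ ⊠ e
      ∂e≋ = mk≋ (λ n → trans (∂-expSeries s n) (sym (⊠≐⊛ σ e n)))

    -- e ⊠ e is e^{2st}, so Num and Den are quadratic in e with constant coefficients.
    NumX DenX ∂NumX ∂DenX ∂e² : Series
    ∂e² = (σ ⊠ e) ⊠ e ⊕ e ⊠ (σ ⊠ e)
    NumX = (Y ⊕ σ) ⊕ (two′ ⊠ X) ⊠ e ⊕ (Y ⊕ ⊝ σ) ⊠ (e ⊠ e)
    DenX = (σ ⊠ σ ⊕ Y ⊠ σ) ⊕ (σ ⊠ σ ⊕ ⊝ (Y ⊠ σ)) ⊠ (e ⊠ e)
    ∂NumX = (two′ ⊠ X) ⊠ (σ ⊠ e) ⊕ (Y ⊕ ⊝ σ) ⊠ ∂e²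
    ∂DenX = (σ ⊠ σ ⊕ ⊝ (Y ⊠ σ)) ⊠ ∂e²

    Num≋ : Num ≋ NumX
    Num≋ = S.+-cong (S.+-cong (S.trans (constSeries≋const _) const-y+s)
                              (S.trans (scaleSeries≋const⊠ _ _) (S.*-congʳ const-2x)))
                    (S.trans (scaleSeries≋const⊠ _ _) (S.*-cong const-y-s e²≋))

    Den≋ : Den ≋ DenX
    Den≋ = S.+-cong (S.trans (constSeries≋const _) (const-δ+ (const≋-* yK s)))
                    (S.trans (scaleSeries≋const⊠ _ _)
                             (S.*-cong (const-δ+ (S.trans (const≋-neg _) (S.-‿cong (const≋-* yK s)))) e²≋))

    private
      ∂-e² : ∂ (e ⊠ e) ≋ ∂e²
      ∂-e² = S.trans (∂.leibniz e e) (S.+-cong (S.*-congʳ ∂e≋) (S.*-congˡ ∂e≋))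

    ∂Num≋ : ∂ Num ≋ ∂NumX
    ∂Num≋ = begin
      ∂ Num                                                     ≈⟨ ∂.cong-δ Num≋ ⟩
      ∂ ((Y ⊕ σ) ⊕ (two′ ⊠ X) ⊠ e ⊕ (Y ⊕ ⊝ σ) ⊠ (e ⊠ e))         ≈⟨ S.trans (∂.δ-+ ((Y ⊕ σ) ⊕ (two′ ⊠ X) ⊠ e) ((Y ⊕ ⊝ σ) ⊠ (e ⊠ e)))
                                                                          (S.+-congʳ (∂.δ-+ (Y ⊕ σ) ((two′ ⊠ X) ⊠ e))) ⟩
      ∂ (Y ⊕ σ) ⊕ ∂ ((two′ ⊠ X) ⊠ e) ⊕ ∂ ((Y ⊕ ⊝ σ) ⊠ (e ⊠ e))
        ≈⟨ S.+-cong (S.+-cong (∂.cong-δ (S.sym const-y+s)) (∂.cong-δ (S.*-congʳ (S.sym const-2x))))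
                    (∂.cong-δ (S.*-congʳ (S.sym const-y-s))) ⟩
      ∂ (const (yK + s)) ⊕ ∂ (const (rat two * xK) ⊠ e) ⊕ ∂ (const (yK - s) ⊠ (e ⊠ e))
        ≈⟨ S.+-cong (S.+-cong (∂-const≋ (yK + s)) (∂-const⊠ (rat two * xK) e)) (∂-const⊠ (yK - s) (e ⊠ e)) ⟩
      𝟘 ⊕ const (rat two * xK) ⊠ ∂ e ⊕ const (yK - s) ⊠ ∂ (e ⊠ e)
        ≈⟨ S.+-cong (S.trans (S.+-identityˡ _) (S.*-cong const-2x ∂e≋)) (S.*-cong const-y-s ∂-e²) ⟩
      ∂NumX                                                     ∎
      where open SR

    ∂Den≋ : ∂ Den ≋ ∂DenX
    ∂Den≋ = begin
      ∂ Den                                                     ≈⟨ ∂.cong-δ (S.+-congˡ {constSeries c₀} (scaleSeries≋const⊠ c₂ _)) ⟩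
      ∂ (constSeries c₀ ⊕ const c₂ ⊠ expSeries (rat two * s))   ≈⟨ ∂.δ-+ (constSeries c₀) (const c₂ ⊠ expSeries (rat two * s)) ⟩
      ∂ (constSeries c₀) ⊕ ∂ (const c₂ ⊠ expSeries (rat two * s))
        ≈⟨ S.+-cong (S.trans (∂.cong-δ (constSeries≋const c₀)) (∂-const≋ c₀)) (∂-const⊠ _ _) ⟩
      𝟘 ⊕ const c₂ ⊠ ∂ (expSeries (rat two * s))                 ≈⟨ S.+-identityˡ _ ⟩
      const c₂ ⊠ ∂ (expSeries (rat two * s))
        ≈⟨ S.*-cong (const-δ+ (S.trans (const≋-neg _) (S.-‿cong (const≋-* yK s)))) (S.trans (∂.cong-δ e²≋) ∂-e²) ⟩
      ∂DenX                                                     ∎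
      where
      open SR
      c₀ c₂ : Carrier
      c₀ = poly δ + yK * s
      c₂ = poly δ - yK * s

    M N : Series
    M = Den
    N = δ′ ⊠ Num

    -- N/M satisfies the Riccati equation 2 (N/M)′ = (N/M)² − δ, because e′ = s e and s² = y² − x².
    closedForm-riccati : (∂ N ⊠ M ⊕ ⊝ (N ⊠ ∂ M)) ⊕ (∂ N ⊠ M ⊕ ⊝ (N ⊠ ∂ M)) ≋ N ⊠ N ⊕ ⊝ (δ′ ⊠ (M ⊠ M))
    closedForm-riccati = begin
      (∂ N ⊠ M ⊕ ⊝ (N ⊠ ∂ M)) ⊕ (∂ N ⊠ M ⊕ ⊝ (N ⊠ ∂ M))         ≈⟨ S.+-cong wronskian≋ wronskian≋ ⟩
      (∂NX ⊠ DenX ⊕ ⊝ (NX ⊠ ∂DenX)) ⊕ (∂NX ⊠ DenX ⊕ ⊝ (NX ⊠ ∂DenX))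
        ≈⟨ solve 4 (λ X Y S E →
             let numX = (Y :+ S) :+ (con two :* X) :* E :+ (Y :- S) :* (E :* E)
                 denX = (S :* S :+ Y :* S) :+ (S :* S :- Y :* S) :* (E :* E)
                 ∂e²X = (S :* E) :* E :+ E :* (S :* E)
                 ∂denX = (S :* S :- Y :* S) :* ∂e²X
                 nX = (S :* S) :* numX
                 ∂nX = (S :* S) :* ((con two :* X) :* (S :* E) :+ (Y :- S) :* ∂e²X)
             in (∂nX :* denX :- nX :* ∂denX) :+ (∂nX :* denX :- nX :* ∂denX)
                := (nX :* nX :- (S :* S) :* (denX :* denX))
                   :+ con four :* (((S :* S) :* (S :* S)) :* (E :* E)) :* (Y :* Y :- X :* X :- S :* S))
             S.refl X Y σ e ⟩
      (NX ⊠ NX ⊕ ⊝ ((σ ⊠ σ) ⊠ (DenX ⊠ DenX))) ⊕ S.ι four ⊠ (((σ ⊠ σ) ⊠ (σ ⊠ σ)) ⊠ (e ⊠ e)) ⊠ (Y ⊠ Y ⊕ ⊝ (X ⊠ X) ⊕ ⊝ (σ ⊠ σ))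
        ≈⟨ S.trans (S.+-congˡ (S.trans (S.*-congˡ y²-x²-s²≋0) (S.zeroʳ _))) (S.+-identityʳ _) ⟩
      NX ⊠ NX ⊕ ⊝ ((σ ⊠ σ) ⊠ (DenX ⊠ DenX))
        ≈⟨ S.sym (S.+-cong (S.*-cong N≋ N≋) (S.-‿cong (S.*-cong δ′≋σ² (S.*-cong Den≋ Den≋)))) ⟩
      N ⊠ N ⊕ ⊝ (δ′ ⊠ (M ⊠ M))                                  ∎
      where
      open SR
      open S.RingSolver using (solve; _:+_; _:*_; _:-_; _:=_; con)
      four : ℚ
      four = + 4 / 1
      NX ∂NX : Series
      NX = (σ ⊠ σ) ⊠ NumX
      ∂NX = (σ ⊠ σ) ⊠ ∂NumX
      N≋ : N ≋ NX
      N≋ = S.*-cong δ′≋σ² Num≋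
      ∂N≋ : ∂ N ≋ ∂NX
      ∂N≋ = S.trans (∂-const⊠ (poly δ) Num) (S.*-cong δ′≋σ² ∂Num≋)
      wronskian≋ : ∂ N ⊠ M ⊕ ⊝ (N ⊠ ∂ M) ≋ ∂NX ⊠ DenX ⊕ ⊝ (NX ⊠ ∂DenX)
      wronskian≋ = S.+-cong (S.*-cong ∂N≋ Den≋) (S.-‿cong (S.*-cong N≋ ∂Den≋))
      y²-x²-s²≋0 : Y ⊠ Y ⊕ ⊝ (X ⊠ X) ⊕ ⊝ (σ ⊠ σ) ≋ 𝟘
      y²-x²-s²≋0 = S.trans (S.+-congˡ (S.-‿cong σ²≋Y²-X²)) (S.-‿inverseʳ _)

    E : Series
    E = W ⊠ M ⊕ ⊝ N

    -- W and N/M satisfy the same Riccati equation, so E = W M − N satisfies a linear one.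
    E-equation : M ⊠ ∂ E ⊕ M ⊠ ∂ E ≋ E ⊠ (E ⊕ N ⊕ N ⊕ ∂ M ⊕ ∂ M)
    E-equation = begin
      M ⊠ ∂ E ⊕ M ⊠ ∂ E                                                 ≈⟨ S.+-cong (S.*-congˡ ∂E≋) (S.*-congˡ ∂E≋) ⟩
      M ⊠ (∂ W ⊠ M ⊕ W ⊠ ∂ M ⊕ ⊝ ∂ N) ⊕ M ⊠ (∂ W ⊠ M ⊕ W ⊠ ∂ M ⊕ ⊝ ∂ N)
        ≈⟨ solve 7 (λ w m n dw dm dn d →
             m :* (dw :* m :+ w :* dm :- dn) :+ m :* (dw :* m :+ w :* dm :- dn)
             := (w :* m :- n) :* ((w :* m :- n) :+ n :+ n :+ dm :+ dm)
                :+ (m :* m) :* ((dw :+ dw) :- (w :* w :- d))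
                :- ((dn :* m :- n :* dm) :+ (dn :* m :- n :* dm) :- (n :* n :- d :* (m :* m))))
             S.refl W M N (∂ W) (∂ M) (∂ N) δ′ ⟩
      E ⊠ (E ⊕ N ⊕ N ⊕ ∂ M ⊕ ∂ M) ⊕ (M ⊠ M) ⊠ ((∂ W ⊕ ∂ W) ⊕ ⊝ (W ⊠ W ⊕ ⊝ δ′))
        ⊕ ⊝ ((∂ N ⊠ M ⊕ ⊝ (N ⊠ ∂ M)) ⊕ (∂ N ⊠ M ⊕ ⊝ (N ⊠ ∂ M)) ⊕ ⊝ (N ⊠ N ⊕ ⊝ (δ′ ⊠ (M ⊠ M))))
        ≈⟨ S.+-cong (S.+-congˡ (S.*-congˡ (difference≋0 riccati-W))) (S.-‿cong (difference≋0 closedForm-riccati)) ⟩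
      E ⊠ (E ⊕ N ⊕ N ⊕ ∂ M ⊕ ∂ M) ⊕ (M ⊠ M) ⊠ 𝟘 ⊕ ⊝ 𝟘
        ≈⟨ S.trans (S.+-cong (S.trans (S.+-congˡ (S.zeroʳ _)) (S.+-identityʳ _)) S.-0#≈0#) (S.+-identityʳ _) ⟩
      E ⊠ (E ⊕ N ⊕ N ⊕ ∂ M ⊕ ∂ M)                                       ∎
      where
      open SR
      open S.RingSolver using (solve; _:+_; _:*_; _:-_; _:=_)
      ∂E≋ : ∂ E ≋ ∂ W ⊠ M ⊕ W ⊠ ∂ M ⊕ ⊝ ∂ N
      ∂E≋ = S.trans (∂.δ-+ (W ⊠ M) (⊝ N)) (S.+-cong (∂.leibniz W M) (∂.δ-neg N))
      difference≋0 : ∀ {u v} → u ≋ v → u ⊕ ⊝ v ≋ 𝟘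
      difference≋0 {u} {v} u≋v = S.trans (S.+-congʳ u≋v) (S.-‿inverseʳ v)

    M-zero : M 0 ≈ poly δ + poly δ
    M-zero = begin
      M 0                                               ≈⟨ +-cong (constSeries≈const _ 0) (*-congˡ (trans (expSeries-zero _) (sym ι-1))) ⟩
      (poly δ + yK * s) + (poly δ - yK * s) * ι 1ℚ      ≈⟨ solve 2 (λ p q → (p :+ q) :+ (p :- q) :* con 1ℚ := p :+ p) refl (poly δ) (yK * s) ⟩
      poly δ + poly δ                                   ∎
      where
      open Relation.Binary.Reasoning.Setoid setoid
      open RingSolver using (solve; _:+_; _:*_; _:-_; _:=_; con)

    2M₀-nonZeroDivisor : NonZeroDivisor (M 0 + M 0)
    2M₀-nonZeroDivisor v 2M₀v≈0 = ·-cancel-suc 3 (trans 4v≈0 (sym (·-zeroʳ _)))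
      where
      open Relation.Binary.Reasoning.Setoid setoid
      open RingSolver using (solve; _:+_; _:*_; _:=_; con)
      4v≈0 : natℚ 4 · v ≈ 0#
      4v≈0 = trans (·≈ι* (natℚ 4) v) (δ-nonZeroDivisor (ι (natℚ 4) * v) (begin
        poly δ * (ι (natℚ 4) * v)                         ≈⟨ solve 2 (λ p v → p :* (con (natℚ 4) :* v) := ((p :+ p) :+ (p :+ p)) :* v)
                                                                     refl (poly δ) v ⟩
        ((poly δ + poly δ) + (poly δ + poly δ)) * v       ≈⟨ *-congʳ (sym (+-cong M-zero M-zero)) ⟩
        (M 0 + M 0) * v                                   ≈⟨ 2M₀v≈0 ⟩
        0#                                                ∎))

    E-zero : E 0 ≈ 0#
    E-zero = begin
      E 0                                                              ≈⟨ +-cong (trans (⊠≐⊛ W M 0) (+-identityˡ _))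
                                                                                 (-‿cong (trans (⊠≐⊛ δ′ Num 0) (+-identityˡ _))) ⟩
      W 0 * M 0 - poly δ * Num 0                                       ≈⟨ +-cong (*-cong (trans (egf-zero w) poly-w) M-zero) (-‿cong (*-congˡ Num-zero)) ⟩
      (xK + yK) * (poly δ + poly δ) - poly δ * ((yK + s) + ι two * xK + (yK - s))
        ≈⟨ solve 4 (λ x y s p → (x :+ y) :* (p :+ p) :- p :* ((y :+ s) :+ con two :* x :+ (y :- s)) := con 0ℚ) refl xK yK s (poly δ) ⟩
      ι 0ℚ                                                             ≈⟨ ι-0 ⟩
      0#                                                               ∎
      where
      open Relation.Binary.Reasoning.Setoid setoid
      open RingSolver using (solve; _:+_; _:*_; _:-_; _:=_; con)
      poly-w : poly w ≈ xK + yK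
      poly-w = trans (poly-+ x y) (sym (+-cong xK≈ yK≈))
      Num-zero : Num 0 ≈ (yK + s) + ι two * xK + (yK - s)
      Num-zero = +-cong (+-cong (constSeries≈const _ 0) (trans (*-congˡ (expSeries-zero s)) (trans (*-identityʳ _) (*-congʳ (rat≈ι two)))))
                        (trans (*-congˡ (expSeries-zero _)) (*-identityʳ _))

    W⊠M≋N : W ⊠ M ≋ N
    W⊠M≋N = begin
      W ⊠ M        ≈⟨ solve 2 (λ a b → a := (a :- b) :+ b) S.refl (W ⊠ M) N ⟩
      E ⊕ N        ≈⟨ S.+-congʳ (mk≋ (C.∂-equation-zero-solution M E F equation E-zero 2M₀-nonZeroDivisor)) ⟩
      𝟘 ⊕ N        ≈⟨ S.+-identityˡ N ⟩
      N            ∎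
      where
      open SR
      open S.RingSolver using (solve; _:+_; _:-_; _:=_)
      F : Series
      F = E ⊕ N ⊕ N ⊕ ∂ M ⊕ ∂ M
      equation : M ⊛ ∂ E ⊕ M ⊛ ∂ E ≐ E ⊛ F
      equation n = trans (sym (+-cong (⊠≐⊛ M (∂ E) n) (⊠≐⊛ M (∂ E) n))) (trans (at E-equation n) (⊠≐⊛ E F n))

    u : Carrier
    u = aK * (yK - xK)

    difference⊠w≋0 : (Gen ⊠ M ⊕ ⊝ (const u ⊠ Num)) ⊠ const (poly w) ≋ 𝟘
    difference⊠w≋0 = begin
      (Gen ⊠ M ⊕ ⊝ (const u ⊠ Num)) ⊠ const (poly w)
        ≈⟨ solve 5 (λ g m k n c → (g :* m :- k :* n) :* c := (g :* c) :* m :- (k :* c) :* n)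
                   S.refl Gen M (const u) Num (const (poly w)) ⟩
      (Gen ⊠ const (poly w)) ⊠ M ⊕ ⊝ ((const u ⊠ const (poly w)) ⊠ Num)
        ≈⟨ S.+-congʳ (S.trans (S.*-congʳ Gen⊠w≋aK⊠W) (S.trans (S.*-assoc _ _ _) (S.*-congˡ W⊠M≋N))) ⟩
      const aK ⊠ (δ′ ⊠ Num) ⊕ ⊝ ((const u ⊠ const (poly w)) ⊠ Num)
        ≈⟨ S.+-cong (S.*-congˡ (S.*-congʳ (S.trans δ′≋σ² σ²≋Y²-X²))) (S.-‿cong (S.*-congʳ (S.*-cong u≋ w≋))) ⟩
      const aK ⊠ ((Y ⊠ Y ⊕ ⊝ (X ⊠ X)) ⊠ Num) ⊕ ⊝ ((const aK ⊠ (Y ⊕ ⊝ X) ⊠ (X ⊕ Y)) ⊠ Num)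
        ≈⟨ solve 4 (λ a y x n → a :* ((y :* y :- x :* x) :* n) :- (a :* (y :- x) :* (x :+ y)) :* n := con 0ℚ)
                   S.refl (const aK) Y X Num ⟩
      S.ι 0ℚ                                                                        ≈⟨ S.ι-0 ⟩
      𝟘                                                                             ∎
      where
      open SR
      open S.RingSolver using (solve; _:+_; _:*_; _:-_; _:=_; con)
      w≋ : const (poly w) ≋ X ⊕ Y
      w≋ = S.trans (const≋-cong (trans (poly-+ x y) (sym (+-cong xK≈ yK≈)))) (const≋-+ xK yK)
      u≋ : const u ≋ const aK ⊠ (Y ⊕ ⊝ X)
      u≋ = S.trans (const≋-* aK _) (S.*-congˡ (S.trans (const≋-+ _ _) (S.+-congˡ (const≋-neg xK))))

    identity : Gen ⊛ Den ≐ scaleSeries u Num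
    identity n = begin
      (Gen ⊛ Den) n                 ≈⟨ sym (⊠≐⊛ Gen Den n) ⟩
      (Gen ⊠ M) n                   ≈⟨ x∙y⁻¹≈ε⇒x≈y _ _ (x+y-nonZeroDivisor (Z n) w⊠Z≈0) ⟩
      (const u ⊠ Num) n             ≈⟨ const-⊠ u Num n ⟩
      u * Num n                     ∎
      where
      open Relation.Binary.Reasoning.Setoid setoid
      open Algebra.Properties.Group +-group using (x∙y⁻¹≈ε⇒x≈y)
      Z : Series
      Z = Gen ⊠ M ⊕ ⊝ (const u ⊠ Num)
      w⊠Z≈0 : poly w * Z n ≈ 0#
      w⊠Z≈0 = trans (sym (const-⊠ (poly w) Z n)) (trans (at (S.*-comm (const (poly w)) Z) n) (at difference⊠w≋0 n))

module ConcreteInstance where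
  open Polynomials using (polyAlgebra; D-isDerivation; D-varA; D-varX; D-varY;
                          x+y-nonZeroDivisor; Δ-nonZeroDivisor)
  open QuadraticExtension
  private
    module P = Polynomials.Poly

  open GeneratingFunction polyAlgebra rAlgebra poly D (λ n f → iterate n D f) ratR powR constPS
                          varA varX varY Δ aR xR yR sR
    using (Hypotheses; identity) public

  constPS≈const : ∀ u n → constPS u n R.≈ PowerSeries.const rAlgebra u n
  constPS≈const u zero    = R.refl
  constPS≈const u (suc n) = R.refl

  hypotheses : Hypotheses
  hypotheses = record
    { poly-cong = poly-cong ; poly-+ = poly-+ ; poly-* = poly-* ; poly-neg = poly-neg
    ; D-isDerivation = D-isDerivation
    ; Dⁿ-zero = λ _ → P.refl ; Dⁿ-suc = λ _ _ → P.refl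
    ; rat≈ι = ratR≈ι ; pow-zero = λ _ → R.refl ; pow-suc = λ _ _ → R.refl
    ; constSeries≈const = constPS≈const
    ; D-a = D-varA ; D-x = D-varX ; D-y = D-varY ; δ≈y²-x² = P.refl
    ; aK≈ = R.refl ; xK≈ = R.refl ; yK≈ = R.refl ; s²≈δ = sR*sR≈Δ
    ; x+y-nonZeroDivisor = poly-nonZeroDivisor {varX +P varY} x+y-nonZeroDivisor
    ; δ-nonZeroDivisor = poly-nonZeroDivisor {Δ} Δ-nonZeroDivisor
    }

open Defs using (Gen; Num; Den)

corollary3p4 : (Gen *PS Den) ≈PS scalePS (aR *R (yR -R xR)) Num
corollary3p4 n = ≋⇒≈P (fst≃ equal) , ≋⇒≈P (snd≃ equal)
  where
  open Polynomials using (≋⇒≈P)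
  open QuadraticExtension using (_≃R_; fst≃; snd≃)
  equal : (Gen *PS Den) n ≃R scalePS (aR *R (yR -R xR)) Num n
  equal = ConcreteInstance.identity ConcreteInstance.hypotheses n
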